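{- Let $n$ and $\delta$ be powers of two and $q=2^\delta$. For any fixed number $Y\in[q^n]$ and any algorithm in the cell-probe model with $w$-bit cells solving the online multiplication problem (with $Y$ known in advance), the expected running time of the algorithm with $X$ chosen uniformly at random from $[q^n]$ is at least $$\frac{\delta}{8w}\sum_{v\in\mathcal{T}}I_{Y,L(v)}-(n-1),$$ where the sum is over internal nodes $v$ of $\mathcal{T}$.
   Context: $[m]=\{0,\dots,m-1\}$. $X[i]$ is the $i$th base-$q$ digit of $X$ (position $0$ least significant), $X[i..j]$ the integer written $X[j]\cdots X[i]$ in base $q$. Online multiplication with $Y$ known: at time $t\in[n]$ digit $X[t]$ arrives and the algorithm must output $Z[t]$, $Z=X\times Y$, before the next digit arrives, using only $X[0],\dots,X[t]$ and $Y$. Cell-probe model: memory of $w$-bit cells, each able to hold the address of any cell; computation free, no state between operations except memory; running time = number of cell reads/writes. $\mathcal{T}$ is a balanced binary tree with $n$ leaves representing times $0,\dots,n-1$ left to right; $L(v)$ is the number of leaves in the left subtree of internal node $v$. With $X'=X[t_0..t_1]$, $Y'=Y[0..(2\ell-1)]$, $Z'=Z[(t_1+1)..t_2]$ ($t_1=t_0+\ell-1$, $t_2=t_1+\ell$): $Y'$ is retrorse if for any fixed values of $t_0$, of the digits of $X$ outside positions $t_0..t_1$, and of $Y[2\ell..(n-1)]$, each value of $Z'$ arises from at most four values of $X'$; $I_{Y,\ell}=\ell$ if $Y'$ is retrorse and $0$ otherwise. -}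

module Defs where

open import Data.Nat using (ℕ; zero; suc; _+_; _*_; _∸_; _^_; _≤_; _<_; NonZero)
open import Data.Nat.Properties using (m^n≢0; m*n≢0)
open import Data.Nat.DivMod using (_/_; _mod_)
open import Data.Fin using (Fin)
open import Data.Fin.Properties using (_≟_)
open import Data.Nat.ListAction using (sum)
open import Data.List using (List; map; upTo; filter; length)
open import Data.Product using (_×_; _,_; proj₁; proj₂)
open import Data.Integer using (+_)
open import Data.Rational using (ℚ) renaming (_/_ to _/ℚ_; _*_ to _*ℚ_; _-_ to _-ℚ_)
open import Relation.Nullary using (Dec; yes; no; ¬_)
import Data.Nat as ℕ

base : ℕ → ℕ
base δ = 2 ^ δ

base≢0 : ∀ δ → NonZero (base δ)
base≢0 δ = m^n≢0 2 δ

-- X[t] : the t-th base-q digit of X (position 0 least significant)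
digit : (q : ℕ) .{{_ : NonZero q}} → ℕ → ℕ → Fin q
digit q X t = ((X / q ^ t) {{m^n≢0 q t}}) mod q

-- X[i..j] : the integer written X[j]⋯X[i] in base q (digits i..i+len-1)
digits : (q : ℕ) .{{_ : NonZero q}} → ℕ → (i len : ℕ) → ℕ
digits q X i len = Data.Fin.toℕ ((((X / q ^ i) {{m^n≢0 q i}}) mod (q ^ len)) {{m^n≢0 q len}})

-- Cell-probe model with w-bit cells.
-- A cell holds a w-bit word; since a cell can hold the address of any
-- cell, addresses are w-bit words as well (2^w cells).

Word : ℕ → Set
Word w = Fin (2 ^ w)

Mem : ℕ → Set
Mem w = Word w → Word w

write : ∀ w → Mem w → Word w → Word w → Mem w
write w m a v b with b ≟ a
... | yes _ = v
... | no  _ = m b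

-- One operation: an adaptive sequence of cell reads/writes (computation
-- is free), ending with an output digit.
data Prog (w : ℕ) (D : Set) : Set where
  out : D → Prog w D
  rd  : Word w → (Word w → Prog w D) → Prog w D
  wr  : Word w → Word w → Prog w D → Prog w D

exec : ∀ {w D} → Prog w D → Mem w → D × Mem w × ℕ
exec (out d) m = d , m , 0
exec (rd a k) m with exec (k (m a)) m
... | d , m' , c = d , m' , suc c
exec {w} (wr a v p) m with exec p (write w m a v)
... | d , m' , c = d , m' , suc c

-- An online algorithm (for the fixed, known-in-advance Y): an initial memory
-- (which may depend arbitrarily on Y) and, for each arriving digit, the
-- operation to run.
record Algorithm (w q : ℕ) : Set where
  field
    init : Mem w
    op   : Fin q → Prog w (Fin q)

module Run {w q : ℕ} .{{_ : NonZero q}} (A : Algorithm w q) (X : ℕ) where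
  open Algorithm A

  memAt : ℕ → Mem w
  memAt zero    = init
  memAt (suc t) = proj₁ (proj₂ (exec (op (digit q X t)) (memAt t)))

  output : ℕ → Fin q
  output t = proj₁ (exec (op (digit q X t)) (memAt t))

  cost : ℕ → ℕ
  cost t = proj₂ (proj₂ (exec (op (digit q X t)) (memAt t)))

  totalTime : ℕ → ℕ
  totalTime n = sum (map cost (upTo n))

Solves : ∀ {w} (q : ℕ) .{{_ : NonZero q}} → Algorithm w q → (n Y : ℕ) → Set
Solves q A n Y = ∀ X → X < q ^ n → ∀ t → t < n → Run.output A X t ≡' digit q (X * Y) t
  where open import Relation.Binary.PropositionalEquality renaming (_≡_ to _≡'_)

expectedTime : ∀ {w} (q : ℕ) .{{_ : NonZero q}} → Algorithm w q → ℕ → ℚ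
expectedTime q A n =
  ((+ sum (map (λ X → Run.totalTime A X n) (upTo (q ^ n)))) /ℚ (q ^ n)) {{m^n≢0 q n}}

-- Y' = Y[0..2ℓ-1].  For t0 with t0 + 2ℓ ≤ n, t1 = t0+ℓ-1,
-- t2 = t1+ℓ, fixed digits of X outside t0..t1 (A below, B above) and
-- fixed Y[2ℓ..n-1] (Yh), each value z of Z' = Z[(t1+1)..t2] arises from
-- at most four values of X' = X[t0..t1] ∈ [q^ℓ].

-- Z' = Z[(t1+1)..t2] as a function of X', where
-- X = Alo + q^t0 · X' + q^(t1+1) · Bhi  and  Y = Y' + q^(2ℓ) · Yh
Zseg : (q : ℕ) .{{_ : NonZero q}} → (Y ℓ t0 Alo Bhi Yh X' : ℕ) → ℕ
Zseg q Y ℓ t0 Alo Bhi Yh X' =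
  digits q ((Alo + q ^ t0 * X' + q ^ (t0 + ℓ) * Bhi)
            * (digits q Y 0 (2 * ℓ) + q ^ (2 * ℓ) * Yh))
         (t0 + ℓ) ℓ

Retrorse : (q : ℕ) .{{_ : NonZero q}} → (n Y ℓ : ℕ) → Set
Retrorse q n Y ℓ =
  ∀ t0 → t0 + 2 * ℓ ≤ n →
  ∀ (Alo : ℕ) → Alo < q ^ t0 →
  ∀ (Bhi : ℕ) → Bhi < q ^ (n ∸ (t0 + ℓ)) →
  ∀ (Yh : ℕ) → Yh < q ^ (n ∸ 2 * ℓ) →
  ∀ (z : ℕ) →
  length (filter (λ X' → Zseg q Y ℓ t0 Alo Bhi Yh X' ℕ.≟ z) (upTo (q ^ ℓ))) ≤ 4

IsI : (q : ℕ) .{{_ : NonZero q}} → (n Y : ℕ) → (ℕ → ℕ) → Set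
IsI q n Y I = ∀ ℓ → (Retrorse q n Y ℓ → I ℓ ≡' ℓ) × (¬ Retrorse q n Y ℓ → I ℓ ≡' 0)
  where open import Relation.Binary.PropositionalEquality renaming (_≡_ to _≡'_)

data Tree : ℕ → Set where
  leaf : Tree 0
  node : ∀ {k} → Tree k → Tree k → Tree (suc k)

balanced : (k : ℕ) → Tree k
balanced zero    = leaf
balanced (suc k) = node (balanced k) (balanced k)

leaves : ∀ {k} → Tree k → ℕ
leaves leaf       = 1
leaves (node l r) = leaves l + leaves r

-- Σ over internal nodes v of f (L(v)), L(v) = #leaves of left subtree
sumInternal : ∀ {k} → (ℕ → ℕ) → Tree k → ℕ
sumInternal f leaf       = 0
sumInternal f (node l r) = f (leaves l) + sumInternal f l + sumInternal f r

bound : (δ w : ℕ) .{{_ : NonZero w}} → (n S : ℕ) → ℚ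
bound δ w n S = ((+ δ) /ℚ (8 * w)) {{m*n≢0 8 w}} *ℚ (+ S /ℚ 1) -ℚ (+ (n ∸ 1) /ℚ 1)

{-# OPTIONS --safe #-}
module Submission where

-- Stamp every memory cell with the time of its last write.  For an internal node whose
-- children cover the times [a, a + ℓ) and [a + ℓ, a + 2ℓ), the reads performed in the right
-- half of cells last written in the left half form a transcript.  The transcript, the memory
-- at time a and the digits of X outside positions a .. a + ℓ - 1 determine, by replaying the
-- right half, the outputs Z', and these determine X' up to four choices when Y' is retrorse.
-- A transcript of c reads costs 2w + 1 bits per read, so for a fixed context at most
-- 4 · 2^((2w+1)c) of the 2^(δℓ) values of X' have transcripts shorter than c; with
-- c ≈ δℓ / (2w + 1) the average transcript length is at least δℓ / (8w) - 1.  Every read is a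
-- transcript read for at most one node, so summing over the n - 1 internal nodes bounds the
-- expected running time.

open import Data.Nat using (ℕ; NonZero; _<_; _^_)
open import Defs using (Algorithm; Solves; IsI; base; base≢0)

module FiniteSums where

  open import Data.Nat
  open import Data.Nat.Properties
  open import Data.List using (List; []; _∷_; _++_; map; filter; length; upTo; applyUpTo)
  open import Data.List.Properties using (map-upTo; length-++)
  open import Data.List.Membership.Propositional using (_∈_)
  open import Data.List.Membership.Propositional.Properties using (∈-++⁺ˡ; ∈-++⁺ʳ; ∈-++⁻)
  open import Data.Nat.ListAction using (sum)
  open import Data.Product using (∃; _×_; _,_)
  open import Data.Sum using (inj₁; inj₂)
  open import Data.Empty using (⊥-elim)
  open import Relation.Nullary using (Dec; yes; no; ¬_)
  open import Relation.Binary.PropositionalEquality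
  open import Function using (_∘_)
  open import Algebra.Properties.CommutativeSemigroup +-commutativeSemigroup using (interchange)

  ∑< : ℕ → (ℕ → ℕ) → ℕ
  ∑< zero    f = 0
  ∑< (suc n) f = f 0 + ∑< n (f ∘ suc)

  syntax ∑< n (λ i → e) = ∑[ i < n ] e

  sum-map-upTo : ∀ n (f : ℕ → ℕ) → sum (map f (upTo n)) ≡ ∑< n f
  sum-map-upTo n f = trans (cong sum (map-upTo f n)) (go n f)
    where
    go : ∀ n (f : ℕ → ℕ) → sum (applyUpTo f n) ≡ ∑< n f
    go zero    f = refl
    go (suc n) f = cong (f 0 +_) (go n (f ∘ suc))

  ∑-cong : ∀ n {f g : ℕ → ℕ} → (∀ i → i < n → f i ≡ g i) → ∑< n f ≡ ∑< n g
  ∑-cong zero    eq = refl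
  ∑-cong (suc n) eq = cong₂ _+_ (eq 0 z<s) (∑-cong n (λ i i<n → eq (suc i) (s<s i<n)))

  ∑-mono-≤ : ∀ n {f g : ℕ → ℕ} → (∀ i → i < n → f i ≤ g i) → ∑< n f ≤ ∑< n g
  ∑-mono-≤ zero    le = z≤n
  ∑-mono-≤ (suc n) le = +-mono-≤ (le 0 z<s) (∑-mono-≤ n (λ i i<n → le (suc i) (s<s i<n)))

  ∑-const : ∀ n c → ∑[ _ < n ] c ≡ n * c
  ∑-const zero    c = refl
  ∑-const (suc n) c = cong (c +_) (∑-const n c)

  ∑-distrib-+ : ∀ n (f g : ℕ → ℕ) → ∑[ i < n ] (f i + g i) ≡ ∑< n f + ∑< n g
  ∑-distrib-+ zero    f g = refl
  ∑-distrib-+ (suc n) f g = begin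
    f 0 + g 0 + ∑[ i < n ] (f (suc i) + g (suc i))  ≡⟨ cong (f 0 + g 0 +_) (∑-distrib-+ n (f ∘ suc) (g ∘ suc)) ⟩
    f 0 + g 0 + (∑< n (f ∘ suc) + ∑< n (g ∘ suc))  ≡⟨ interchange (f 0) (g 0) _ _ ⟩
    f 0 + ∑< n (f ∘ suc) + (g 0 + ∑< n (g ∘ suc))  ∎
    where open ≡-Reasoning

  ∑-*-distribˡ : ∀ n c (f : ℕ → ℕ) → ∑[ i < n ] (c * f i) ≡ c * ∑< n f
  ∑-*-distribˡ zero    c f = sym (*-zeroʳ c)
  ∑-*-distribˡ (suc n) c f =
    trans (cong (c * f 0 +_) (∑-*-distribˡ n c (f ∘ suc))) (sym (*-distribˡ-+ c (f 0) _))

  ∑-split : ∀ m k (f : ℕ → ℕ) → ∑< (m + k) f ≡ ∑< m f + ∑[ i < k ] f (m + i)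
  ∑-split zero    k f = refl
  ∑-split (suc m) k f = trans (cong (f 0 +_) (∑-split m k (f ∘ suc))) (sym (+-assoc (f 0) _ _))

  ∑-comm : ∀ n m (f : ℕ → ℕ → ℕ) → ∑[ i < n ] ∑[ j < m ] f i j ≡ ∑[ j < m ] ∑[ i < n ] f i j
  ∑-comm zero    m f = sym (trans (∑-const m 0) (*-zeroʳ m))
  ∑-comm (suc n) m f = begin
    ∑< m (f 0) + ∑[ i < n ] ∑[ j < m ] f (suc i) j  ≡⟨ cong (∑< m (f 0) +_) (∑-comm n m (f ∘ suc)) ⟩
    ∑< m (f 0) + ∑[ j < m ] ∑[ i < n ] f (suc i) j  ≡⟨ ∑-distrib-+ m (f 0) _ ⟨
    ∑[ j < m ] (f 0 j + ∑[ i < n ] f (suc i) j)     ∎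
    where open ≡-Reasoning

  ∑-range-* : ∀ a m (f : ℕ → ℕ) → ∑< (a * m) f ≡ ∑[ y < m ] ∑[ i < a ] f (a * y + i)
  ∑-range-* a zero    f rewrite *-zeroʳ a = refl
  ∑-range-* a (suc m) f = begin
    ∑< (a * suc m) f                                                ≡⟨ cong (λ r → ∑< r f) (*-suc a m) ⟩
    ∑< (a + a * m) f                                                ≡⟨ ∑-split a (a * m) f ⟩
    ∑< a f + ∑[ i < a * m ] f (a + i)
      ≡⟨ cong₂ _+_ (∑-cong a λ i _ → cong (λ z → f (z + i)) (sym (*-zeroʳ a)))
                                                                                (∑-range-* a m (λ i → f (a + i))) ⟩
    ∑[ i < a ] f (a * 0 + i) + ∑[ y < m ] ∑[ i < a ] f (a + (a * y + i))
                                                                    ≡⟨ cong (∑[ i < a ] f (a * 0 + i) +_)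
                                                                         (∑-cong m λ y _ → ∑-cong a λ i _ → cong f (shift y i)) ⟩
    ∑[ i < a ] f (a * 0 + i) + ∑[ y < m ] ∑[ i < a ] f (a * suc y + i) ∎
    where
    open ≡-Reasoning
    shift : ∀ y i → a + (a * y + i) ≡ a * suc y + i
    shift y i = trans (sym (+-assoc a (a * y) i)) (cong (_+ i) (sym (*-suc a y)))

  ∑>0⇒∃ : ∀ n (f : ℕ → ℕ) → 0 < ∑< n f → ∃ λ i → i < n × 0 < f i
  ∑>0⇒∃ (suc n) f pos with f 0 in eq
  ... | suc _ = 0 , z<s , subst (0 <_) (sym eq) z<s
  ... | zero with ∑>0⇒∃ n (f ∘ suc) pos
  ...   | i , i<n , fi>0 = suc i , s<s i<n , fi>0

  concat< : ∀ {a} {A : Set a} → ℕ → (ℕ → List A) → List A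
  concat< zero    f = []
  concat< (suc n) f = f 0 ++ concat< n (f ∘ suc)

  length-concat< : ∀ {a} {A : Set a} n (f : ℕ → List A) → length (concat< n f) ≡ ∑[ i < n ] length (f i)
  length-concat< zero    f = refl
  length-concat< (suc n) f = trans (length-++ (f 0)) (cong (length (f 0) +_) (length-concat< n (f ∘ suc)))

  ∈-concat<⁺ : ∀ {a} {A : Set a} {x : A} n (f : ℕ → List A) i → i < n → x ∈ f i → x ∈ concat< n f
  ∈-concat<⁺ (suc n) f zero    _         x∈ = ∈-++⁺ˡ x∈
  ∈-concat<⁺ (suc n) f (suc i) (s<s i<n) x∈ = ∈-++⁺ʳ (f 0) (∈-concat<⁺ n (f ∘ suc) i i<n x∈)

  ∈-concat<⁻ : ∀ {a} {A : Set a} {x : A} n (f : ℕ → List A) → x ∈ concat< n f → ∃ λ i → i < n × x ∈ f i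
  ∈-concat<⁻ (suc n) f x∈ with ∈-++⁻ (f 0) x∈
  ... | inj₁ x∈f0 = 0 , z<s , x∈f0
  ... | inj₂ x∈fs with ∈-concat<⁻ n (f ∘ suc) x∈fs
  ...   | i , i<n , x∈fi = suc i , s<s i<n , x∈fi

  𝟙 : ∀ {p} {P : Set p} → Dec P → ℕ
  𝟙 (yes _) = 1
  𝟙 (no _)  = 0

  𝟙-mono : ∀ {p q} {P : Set p} {Q : Set q} (P? : Dec P) (Q? : Dec Q) → (P → Q) → 𝟙 P? ≤ 𝟙 Q?
  𝟙-mono (yes _) (yes _) _   = ≤-refl
  𝟙-mono (yes p) (no ¬q) P→Q = ⊥-elim (¬q (P→Q p))
  𝟙-mono (no _)  _       _   = z≤n

  𝟙-cong : ∀ {p q} {P : Set p} {Q : Set q} (P? : Dec P) (Q? : Dec Q) → (P → Q) → (Q → P) → 𝟙 P? ≡ 𝟙 Q?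
  𝟙-cong P? Q? P→Q Q→P = ≤-antisym (𝟙-mono P? Q? P→Q) (𝟙-mono Q? P? Q→P)

  𝟙-reject : ∀ {p} {P : Set p} (P? : Dec P) → ¬ P → 𝟙 P? ≡ 0
  𝟙-reject (yes p) ¬p = ⊥-elim (¬p p)
  𝟙-reject (no _)  _  = refl

  length-filter-∷ : ∀ {a p} {A : Set a} {P : A → Set p} (P? : ∀ x → Dec (P x)) x xs →
    length (filter P? (x ∷ xs)) ≡ 𝟙 (P? x) + length (filter P? xs)
  length-filter-∷ P? x xs with P? x
  ... | yes _ = refl
  ... | no _  = refl

  length-filter-applyUpTo : ∀ {p} {P : ℕ → Set p} (P? : ∀ x → Dec (P x)) n (f : ℕ → ℕ) →
    length (filter P? (applyUpTo f n)) ≡ ∑[ i < n ] 𝟙 (P? (f i))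
  length-filter-applyUpTo P? zero    f = refl
  length-filter-applyUpTo P? (suc n) f =
    trans (length-filter-∷ P? (f 0) _) (cong (𝟙 (P? (f 0)) +_) (length-filter-applyUpTo P? n (f ∘ suc)))

  length-filter-partition : ∀ {a p q r} {A : Set a} {P : A → Set p} {Q : A → Set q} {R : A → Set r}
    (P? : ∀ x → Dec (P x)) (Q? : ∀ x → Dec (Q x)) (R? : ∀ x → Dec (R x)) →
    (∀ x → 𝟙 (P? x) ≡ 𝟙 (Q? x) + 𝟙 (R? x)) →
    ∀ xs → length (filter P? xs) ≡ length (filter Q? xs) + length (filter R? xs)
  length-filter-partition P? Q? R? split []       = refl
  length-filter-partition P? Q? R? split (x ∷ xs) = begin
    length (filter P? (x ∷ xs))                                            ≡⟨ length-filter-∷ P? x xs ⟩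
    𝟙 (P? x) + length (filter P? xs)
      ≡⟨ cong₂ _+_ (split x) (length-filter-partition P? Q? R? split xs) ⟩
    (𝟙 (Q? x) + 𝟙 (R? x)) + (length (filter Q? xs) + length (filter R? xs)) ≡⟨ interchange (𝟙 (Q? x)) _ _ _ ⟩
    (𝟙 (Q? x) + length (filter Q? xs)) + (𝟙 (R? x) + length (filter R? xs)) ≡⟨ cong₂ _+_ (length-filter-∷ Q? x xs) (length-filter-∷ R? x xs) ⟨
    length (filter Q? (x ∷ xs)) + length (filter R? (x ∷ xs))              ∎
    where open ≡-Reasoning

  𝟙<≡∑𝟙≡ : ∀ k m → 𝟙 (m <? k) ≡ ∑[ z < k ] 𝟙 (m ≟ z)
  𝟙<≡∑𝟙≡ zero    m       = 𝟙-reject (m <? 0) λ ()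
  𝟙<≡∑𝟙≡ (suc k) zero    = cong suc (sym (begin
    ∑[ z < k ] 𝟙 (0 ≟ suc z)     ≡⟨ ∑-cong k (λ z _ → 𝟙-reject (0 ≟ suc z) λ ()) ⟩
    ∑[ _ < k ] 0                 ≡⟨ ∑-const k 0 ⟩
    k * 0                        ≡⟨ *-zeroʳ k ⟩
    0                            ∎))
    where open ≡-Reasoning
  𝟙<≡∑𝟙≡ (suc k) (suc m) = begin
    𝟙 (suc m <? suc k)                             ≡⟨ 𝟙-cong (suc m <? suc k) (m <? k) s≤s⁻¹ s≤s ⟩
    𝟙 (m <? k)                                      ≡⟨ 𝟙<≡∑𝟙≡ k m ⟩
    ∑[ z < k ] 𝟙 (m ≟ z)
      ≡⟨ ∑-cong k (λ z _ → 𝟙-cong (m ≟ z) (suc m ≟ suc z) (cong suc) suc-injective) ⟩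
    ∑[ z < k ] 𝟙 (suc m ≟ suc z)                    ≡⟨ cong (_+ ∑[ z < k ] 𝟙 (suc m ≟ suc z)) (𝟙-reject (suc m ≟ 0) λ ()) ⟨
    𝟙 (suc m ≟ 0) + ∑[ z < k ] 𝟙 (suc m ≟ suc z)    ∎
    where open ≡-Reasoning

  fibres-≤-factor : ∀ n c (g Z : ℕ → ℕ) →
    (∀ x y → x < n → y < n → g x ≡ g y → Z x ≡ Z y) →
    (∀ z → ∑[ x < n ] 𝟙 (Z x ≟ z) ≤ c) →
    ∀ z → ∑[ x < n ] 𝟙 (g x ≟ z) ≤ c
  fibres-≤-factor n c g Z factor fibreZ z with ∑[ x < n ] 𝟙 (g x ≟ z) in eq
  ... | zero  = z≤n
  ... | suc _ with ∑>0⇒∃ n (λ x → 𝟙 (g x ≟ z)) (subst (0 <_) (sym eq) z<s)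
  ...   | x₀ , x₀<n , hit = subst (_≤ c) eq (≤-trans (∑-mono-≤ n same-fibre) (fibreZ (Z x₀)))
    where
    gx₀≡z : g x₀ ≡ z
    gx₀≡z with g x₀ ≟ z
    ... | yes e = e
    ... | no _  = ⊥-elim (<-irrefl refl hit)
    same-fibre : ∀ x → x < n → 𝟙 (g x ≟ z) ≤ 𝟙 (Z x ≟ Z x₀)
    same-fibre x x<n = 𝟙-mono (g x ≟ z) (Z x ≟ Z x₀) (λ e → factor x x₀ x<n x₀<n (trans e (sym gx₀≡z)))

  count-below-≤ : ∀ n c k (g : ℕ → ℕ) →
    (∀ z → ∑[ x < n ] 𝟙 (g x ≟ z) ≤ c) →
    ∑[ x < n ] 𝟙 (g x <? k) ≤ c * k
  count-below-≤ n c k g fibre = begin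
    ∑[ x < n ] 𝟙 (g x <? k)                 ≡⟨ ∑-cong n (λ x _ → 𝟙<≡∑𝟙≡ k (g x)) ⟩
    ∑[ x < n ] ∑[ z < k ] 𝟙 (g x ≟ z)       ≡⟨ ∑-comm n k (λ x z → 𝟙 (g x ≟ z)) ⟩
    ∑[ z < k ] ∑[ x < n ] 𝟙 (g x ≟ z)       ≤⟨ ∑-mono-≤ k (λ z _ → fibre z) ⟩
    ∑[ _ < k ] c                            ≡⟨ ∑-const k c ⟩
    k * c                                   ≡⟨ *-comm k c ⟩
    c * k                                   ∎
    where open ≤-Reasoning

  ∑-threshold : ∀ n c k m (f g : ℕ → ℕ) →
    (∀ x → x < n → f x < c → g x < k) →
    ∑[ x < n ] 𝟙 (g x <? k) ≤ m →
    c * n ≤ ∑< n f + c * m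
  ∑-threshold n c k m f g small⇒below count = begin
    c * n                                             ≡⟨ trans (*-comm c n) (sym (∑-const n c)) ⟩
    ∑[ _ < n ] c                                      ≤⟨ ∑-mono-≤ n pointwise ⟩
    ∑[ x < n ] (f x + c * 𝟙 (g x <? k))               ≡⟨ ∑-distrib-+ n f _ ⟩
    ∑< n f + ∑[ x < n ] (c * 𝟙 (g x <? k))            ≡⟨ cong (∑< n f +_) (∑-*-distribˡ n c _) ⟩
    ∑< n f + c * ∑[ x < n ] 𝟙 (g x <? k)              ≤⟨ +-monoʳ-≤ (∑< n f) (*-monoʳ-≤ c count) ⟩
    ∑< n f + c * m                                    ∎
    where
    open ≤-Reasoning
    pointwise : ∀ x → x < n → c ≤ f x + c * 𝟙 (g x <? k)
    pointwise x x<n with c ≤? f x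
    ... | yes c≤fx = ≤-trans c≤fx (m≤m+n (f x) _)
    ... | no c≰fx with g x <? k
    ...   | yes _     = ≤-trans (≤-reflexive (sym (*-identityʳ c))) (m≤n+m (c * 1) (f x))
    ...   | no gx≮k   = ⊥-elim (gx≮k (small⇒below x x<n (≰⇒> c≰fx)))

module Digits where

  open import Data.Nat
  open import Data.Nat.Properties
  open import Data.Nat.DivMod
  open import Data.Nat.Divisibility using (divides; n∣m*n)
  open import Data.Fin using (toℕ)
  open import Data.Fin.Properties using (toℕ-injective; toℕ-fromℕ<)
  open import Data.Product using (_×_; _,_)
  open import Data.Empty using (⊥-elim)
  open import Relation.Binary.PropositionalEquality
  open import Relation.Binary.Definitions using (tri<; tri≈; tri>)
  open import Data.Nat.Tactic.RingSolver using (solve-∀)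
  open import Defs using (digit; digits)

  mixed-radix-< : ∀ a b r s → r < a → s < b → r + a * s < a * b
  mixed-radix-< a b r s r<a s<b = begin-strict
    r + a * s   <⟨ +-monoˡ-< (a * s) r<a ⟩
    a + a * s   ≡⟨ *-suc a s ⟨
    a * suc s   ≤⟨ *-monoʳ-≤ a s<b ⟩
    a * b       ∎
    where open ≤-Reasoning

  mixed-radix-<-high : ∀ a r₁ r₂ s₁ s₂ → r₁ < a → s₁ < s₂ → r₁ + a * s₁ < r₂ + a * s₂
  mixed-radix-<-high a r₁ r₂ s₁ s₂ r₁<a s₁<s₂ =
    <-≤-trans (mixed-radix-< a s₂ r₁ s₁ r₁<a s₁<s₂) (m≤n+m (a * s₂) r₂)

  mixed-radix-injective : ∀ a r₁ r₂ s₁ s₂ → r₁ < a → r₂ < a →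
    r₁ + a * s₁ ≡ r₂ + a * s₂ → r₁ ≡ r₂ × s₁ ≡ s₂
  mixed-radix-injective a r₁ r₂ s₁ s₂ r₁<a r₂<a eq with <-cmp s₁ s₂
  ... | tri≈ _ refl _ = +-cancelʳ-≡ (a * s₁) r₁ r₂ eq , refl
  ... | tri< s₁<s₂ _ _ = ⊥-elim (<-irrefl eq (mixed-radix-<-high a r₁ r₂ s₁ s₂ r₁<a s₁<s₂))
  ... | tri> _ _ s₂<s₁ = ⊥-elim (<-irrefl (sym eq) (mixed-radix-<-high a r₂ r₁ s₂ s₁ r₂<a s₂<s₁))

  module _ (q : ℕ) .{{_ : NonZero q}} where

    toℕ-digit : ∀ x t → toℕ (digit q x t) ≡ (x / q ^ t) {{m^n≢0 q t}} % q
    toℕ-digit x t = toℕ-fromℕ< _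
      where
      instance _ = m^n≢0 q t

    digit-cong : ∀ x y t u → (x / q ^ t) {{m^n≢0 q t}} % q ≡ (y / q ^ u) {{m^n≢0 q u}} % q →
      digit q x t ≡ digit q y u
    digit-cong x y t u eq = toℕ-injective (trans (toℕ-digit x t) (trans eq (sym (toℕ-digit y u))))
      where
      instance
        _ = m^n≢0 q t
        _ = m^n≢0 q u

    [r+q^t*k]/q^t≡r/q^t+k : ∀ r k t →
      ((r + q ^ t * k) / q ^ t) {{m^n≢0 q t}} ≡ (r / q ^ t) {{m^n≢0 q t}} + k
    [r+q^t*k]/q^t≡r/q^t+k r k t = begin
      (r + q ^ t * k) / q ^ t            ≡⟨ +-distrib-/-∣ʳ r (divides k (*-comm (q ^ t) k)) ⟩
      r / q ^ t + q ^ t * k / q ^ t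
        ≡⟨ cong (r / q ^ t +_) (trans (/-congˡ {o = q ^ t} (*-comm (q ^ t) k)) (m*n/n≡m k (q ^ t))) ⟩
      r / q ^ t + k                      ∎
      where
      open ≡-Reasoning
      instance _ = m^n≢0 q t

    digit-low : ∀ r s m t → t < m → digit q (r + q ^ m * s) t ≡ digit q r t
    digit-low r s m t t<m = digit-cong _ _ t t (begin
      (r + q ^ m * s) / q ^ t % q                  ≡⟨ cong (λ z → (r + z) / q ^ t % q) split ⟩
      (r + q ^ t * (k * q)) / q ^ t % q            ≡⟨ cong (_% q) ([r+q^t*k]/q^t≡r/q^t+k r (k * q) t) ⟩
      (r / q ^ t + k * q) % q                      ≡⟨ [m+kn]%n≡m%n (r / q ^ t) k q ⟩
      r / q ^ t % q                                ∎)
      where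
      instance _ = m^n≢0 q t
      open ≡-Reasoning
      d k : ℕ
      d = m ∸ suc t
      k = q ^ d * s
      split : q ^ m * s ≡ q ^ t * (k * q)
      split = begin
        q ^ m * s                ≡⟨ cong (λ e → q ^ e * s) (trans (sym (m+[n∸m]≡n t<m)) (sym (+-suc t d))) ⟩
        q ^ (t + suc d) * s      ≡⟨ cong (_* s) (^-distribˡ-+-* q t (suc d)) ⟩
        q ^ t * (q * q ^ d) * s  ≡⟨ regroup (q ^ t) (q ^ d) q s ⟩
        q ^ t * (k * q)          ∎
        where
        regroup : ∀ A B q s → A * (q * B) * s ≡ A * (B * s * q)
        regroup = solve-∀

    digit-high : ∀ r s m u → r < q ^ m → digit q (r + q ^ m * s) (m + u) ≡ digit q s u
    digit-high r s m u r<q^m = digit-cong _ _ (m + u) u (cong (_% q) (begin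
      (r + q ^ m * s) / q ^ (m + u)          ≡⟨ /-congʳ (^-distribˡ-+-* q m u) ⟩
      (r + q ^ m * s) / (q ^ m * q ^ u)      ≡⟨ m/n/o≡m/[n*o] (r + q ^ m * s) (q ^ m) (q ^ u) ⟨
      (r + q ^ m * s) / q ^ m / q ^ u
        ≡⟨ /-congˡ {o = q ^ u} (trans ([r+q^t*k]/q^t≡r/q^t+k r s m) (cong (_+ s) (m<n⇒m/n≡0 r<q^m))) ⟩
      s / q ^ u                              ∎))
      where
      instance
        _ = m^n≢0 q m
        _ = m^n≢0 q u
        _ = m^n≢0 q (m + u)
        _ = m*n≢0 (q ^ m) (q ^ u)
      open ≡-Reasoning

    digits-suc : ∀ x i len → digits q x i (suc len) ≡ toℕ (digit q x i) + digits q x (suc i) len * q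
    digits-suc x i len = begin
      digits q x i (suc len)                                ≡⟨ toℕ-fromℕ< _ ⟩
      x / q ^ i % (q * q ^ len)                             ≡⟨ %-congʳ (*-comm q (q ^ len)) ⟩
      x / q ^ i % (q ^ len * q)                             ≡⟨ m≡m%n+[m/n]*n (x / q ^ i % (q ^ len * q)) q ⟩
      x / q ^ i % (q ^ len * q) % q
        + x / q ^ i % (q ^ len * q) / q * q                 ≡⟨ cong₂ (λ a b → a + b * q)
                                                                 (m∣n⇒o%n%m≡o%m q (q ^ len * q) (x / q ^ i) (n∣m*n (q ^ len)))
                                                                 (m%[n*o]/o≡m/o%n (x / q ^ i) (q ^ len) q) ⟩
      x / q ^ i % q + x / q ^ i / q % q ^ len * q
        ≡⟨ cong₂ (λ a b → a + b % q ^ len * q) (sym (toℕ-digit x i)) shift ⟩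
      toℕ (digit q x i) + x / q ^ suc i % q ^ len * q
        ≡⟨ cong (λ z → toℕ (digit q x i) + z * q) (toℕ-fromℕ< (m%n<n (x / q ^ suc i) (q ^ len))) ⟨
      toℕ (digit q x i) + digits q x (suc i) len * q        ∎
      where
      instance
        _ = m^n≢0 q i
        _ = m^n≢0 q len
        _ = m^n≢0 q (suc i)
        _ = m^n≢0 q (suc len)
        _ = m*n≢0 (q ^ len) q
        _ = m*n≢0 (q ^ i) q
      open ≡-Reasoning
      shift : x / q ^ i / q ≡ x / q ^ suc i
      shift = trans (m/n/o≡m/[n*o] x (q ^ i) q) (/-congʳ (*-comm (q ^ i) q))

    digits-cong : ∀ x y i len → (∀ u → u < len → digit q x (i + u) ≡ digit q y (i + u)) →
      digits q x i len ≡ digits q y i len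
    digits-cong x y i zero    _  =
      trans (toℕ-fromℕ< _) (trans (n%1≡0 (x / q ^ i)) (sym (trans (toℕ-fromℕ< _) (n%1≡0 (y / q ^ i)))))
      where instance _ = m^n≢0 q i
    digits-cong x y i (suc len) eq = begin
      digits q x i (suc len)                             ≡⟨ digits-suc x i len ⟩
      toℕ (digit q x i) + digits q x (suc i) len * q
        ≡⟨ cong₂ (λ a b → toℕ a + b * q) eq₀ (digits-cong x y (suc i) len eq₊) ⟩
      toℕ (digit q y i) + digits q y (suc i) len * q     ≡⟨ digits-suc y i len ⟨
      digits q y i (suc len)                             ∎
      where
      instance _ = m^n≢0 q i
      open ≡-Reasoning
      at : ∀ {t u} → t ≡ u → digit q x t ≡ digit q y t → digit q x u ≡ digit q y u
      at e = subst (λ z → digit q x z ≡ digit q y z) e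
      eq₀ : digit q x i ≡ digit q y i
      eq₀ = at (+-identityʳ i) (eq 0 z<s)
      eq₊ : ∀ u → u < len → digit q x (suc i + u) ≡ digit q y (suc i + u)
      eq₊ u u<len = at (+-suc i u) (eq (suc u) (s<s u<len))

    digits-low+high : ∀ y len → digits q y 0 len + q ^ len * (y / q ^ len) {{m^n≢0 q len}} ≡ y
    digits-low+high y len = begin
      digits q y 0 len + q ^ len * (y / q ^ len)    ≡⟨ cong₂ _+_ (toℕ-fromℕ< _) (*-comm (q ^ len) _) ⟩
      y / 1 % q ^ len + y / q ^ len * q ^ len       ≡⟨ cong (λ z → z % q ^ len + y / q ^ len * q ^ len) (n/1≡n y) ⟩
      y % q ^ len + y / q ^ len * q ^ len           ≡⟨ m≡m%n+[m/n]*n y (q ^ len) ⟨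
      y                                             ∎
      where
      open ≡-Reasoning
      instance _ = m^n≢0 q len

    high-part-< : ∀ y n k → k ≤ n → y < q ^ n → (y / q ^ k) {{m^n≢0 q k}} < q ^ (n ∸ k)
    high-part-< y n k k≤n y<q^n = m<n*o⇒m/o<n (subst (y <_) q^n≡ y<q^n)
      where
      instance _ = m^n≢0 q k
      q^n≡ : q ^ n ≡ q ^ (n ∸ k) * q ^ k
      q^n≡ = trans (cong (q ^_) (sym (m∸n+n≡m k≤n))) (^-distribˡ-+-* q (n ∸ k) k)

module WordPairLists (w : ℕ) where

  open import Data.Nat hiding (_≟_)
  open import Data.Nat.Properties hiding (_≟_)
  open import Data.Fin using (toℕ)
  open import Data.Fin.Properties using (toℕ-injective; toℕ<n; _≟_)
  open import Data.List using (List; []; _∷_; length)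
  open import Data.List.Relation.Unary.All using (All; []; _∷_)
  open import Data.List.Relation.Unary.Any using (here; there)
  open import Data.List.Membership.Propositional using (_∈_)
  open import Data.Product using (_×_; _,_; proj₁; proj₂)
  open import Data.Empty using (⊥-elim)
  open import Relation.Nullary using (yes; no)
  open import Relation.Binary.PropositionalEquality
  open import Defs using (Word)
  open Digits using (mixed-radix-<; mixed-radix-injective)

  private
    W : ℕ
    W = 2 ^ w

  radix : ℕ
  radix = suc (W * W)

  pairCode : Word w × Word w → ℕ
  pairCode (x , y) = toℕ x + W * toℕ y

  pairCode< : ∀ e → pairCode e < W * W
  pairCode< (x , y) = mixed-radix-< W W (toℕ x) (toℕ y) (toℕ<n x) (toℕ<n y)

  pairCode-injective : ∀ e₁ e₂ → pairCode e₁ ≡ pairCode e₂ → e₁ ≡ e₂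
  pairCode-injective (x₁ , y₁) (x₂ , y₂) eq
    with mixed-radix-injective W (toℕ x₁) (toℕ x₂) (toℕ y₁) (toℕ y₂) (toℕ<n x₁) (toℕ<n x₂) eq
  ... | x≡ , y≡ = cong₂ _,_ (toℕ-injective x≡) (toℕ-injective y≡)

  -- The entries become the base-radix digits 1 + pairCode e; as these are nonzero, lists of
  -- different lengths get different codes.
  listCode : List (Word w × Word w) → ℕ
  listCode []      = 0
  listCode (e ∷ l) = suc (pairCode e) + radix * listCode l

  listCode-injective : ∀ l₁ l₂ → listCode l₁ ≡ listCode l₂ → l₁ ≡ l₂
  listCode-injective []        []        _  = refl
  listCode-injective (e₁ ∷ l₁) (e₂ ∷ l₂) eq
    with mixed-radix-injective radix (suc (pairCode e₁)) (suc (pairCode e₂)) (listCode l₁) (listCode l₂)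
           (s≤s (pairCode< e₁)) (s≤s (pairCode< e₂)) eq
  ... | e≡ , l≡ = cong₂ _∷_ (pairCode-injective e₁ e₂ (suc-injective e≡)) (listCode-injective l₁ l₂ l≡)

  listCode< : ∀ c l → length l ≤ c → listCode l < radix ^ c
  listCode< c       []      _             = m^n>0 radix c
  listCode< (suc c) (e ∷ l) (s≤s |l|≤c) =
    mixed-radix-< radix (radix ^ c) (suc (pairCode e)) (listCode l) (s≤s (pairCode< e)) (listCode< c l |l|≤c)

  radix≤2^[2w+1] : radix ≤ 2 ^ (2 * w + 1)
  radix≤2^[2w+1] = begin
    1 + W * W              ≤⟨ +-monoˡ-≤ (W * W) (subst (0 <_) (^-distribˡ-+-* 2 w w) (m^n>0 2 (w + w))) ⟩
    W * W + W * W          ≡⟨ cong (W * W +_) (+-identityʳ (W * W)) ⟨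
    2 * (W * W)            ≡⟨ cong (2 *_) (^-distribˡ-+-* 2 w w) ⟨
    2 * 2 ^ (w + w)        ≡⟨ cong (λ e → 2 * 2 ^ (w + e)) (+-identityʳ w) ⟨
    2 * 2 ^ (2 * w)        ≡⟨ cong (2 ^_) (+-comm (2 * w) 1) ⟨
    2 ^ (2 * w + 1)        ∎
    where open ≤-Reasoning

  lookupOr : Word w → List (Word w × Word w) → Word w → Word w
  lookupOr c []             d = d
  lookupOr c ((c′ , v) ∷ l) d with c ≟ c′
  ... | yes _ = v
  ... | no  _ = lookupOr c l d

  lookupOr-∈ : ∀ c v d l → All (λ e → proj₁ e ≡ c → proj₂ e ≡ v) l → (c , v) ∈ l → lookupOr c l d ≡ v
  lookupOr-∈ c v d ((c′ , v′) ∷ l) (fun ∷ funs) c,v∈ with c ≟ c′ | c,v∈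
  ... | yes c≡c′ | _           = fun (sym c≡c′)
  ... | no  c≢c′ | here refl   = ⊥-elim (c≢c′ refl)
  ... | no  _    | there c,v∈l = lookupOr-∈ c v d l funs c,v∈l

  lookupOr-∉ : ∀ c d l → All (λ e → proj₁ e ≢ c) l → lookupOr c l d ≡ d
  lookupOr-∉ c d []             []           = refl
  lookupOr-∉ c d ((c′ , v) ∷ l) (c′≢c ∷ ≢s) with c ≟ c′
  ... | yes c≡c′ = ⊥-elim (c′≢c (sym c≡c′))
  ... | no  _    = lookupOr-∉ c d l ≢s

module InformationArithmetic (w : ℕ) .{{_ : NonZero w}} where

  open import Data.Nat
  open import Data.Nat.Properties
  open import Data.Nat.DivMod
  open import Relation.Binary.PropositionalEquality
  open import Data.Nat.Tactic.RingSolver using (solve-∀)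

  private
    m : ℕ
    m = 2 * w + 1

    instance
      m≢0 : NonZero m
      m≢0 = subst NonZero (+-comm 1 (2 * w)) _

  -- The largest c with (2w + 1) c + 3 ≤ d: inputs whose transcript has fewer than c reads of
  -- 2w + 1 bits each then make up at most an eighth of all 2^d inputs (see 8K≤2^d).
  threshold : ℕ → ℕ
  threshold d = (d ∸ 3) / m

  threshold*m≤d∸3 : ∀ d → threshold d * m ≤ d ∸ 3
  threshold*m≤d∸3 d = m/n*n≤m (d ∸ 3) m

  d≤4w*threshold+8w : ∀ d → d ≤ 4 * w * threshold d + 8 * w
  d≤4w*threshold+8w d = begin
    d                                    ≤⟨ m≤n+m∸n d 3 ⟩
    3 + (d ∸ 3)                          ≡⟨ cong (3 +_) (m≡m%n+[m/n]*n (d ∸ 3) m) ⟩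
    3 + ((d ∸ 3) % m + c * m)            ≤⟨ +-monoʳ-≤ 3 (+-monoˡ-≤ (c * m) (<⇒≤ (m%n<n (d ∸ 3) m))) ⟩
    3 + (m + c * m)                      ≡⟨ expand c w ⟩
    2 * w * c + c + 2 * w + 4            ≤⟨ +-monoˡ-≤ 4 (+-monoˡ-≤ (2 * w) (+-monoʳ-≤ (2 * w * c) (m≤n*m c (2 * w)))) ⟩
    2 * w * c + 2 * w * c + 2 * w + 4    ≤⟨ +-monoʳ-≤ (2 * w * c + 2 * w * c + 2 * w) (*-monoʳ-≤ 4 (>-nonZero⁻¹ w)) ⟩
    2 * w * c + 2 * w * c + 2 * w + 4 * w
      ≡⟨ collect c w ⟩
    4 * w * c + 6 * w                    ≤⟨ +-monoʳ-≤ (4 * w * c) (*-monoˡ-≤ w (m≤m+n 6 2)) ⟩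
    4 * w * c + 8 * w                    ∎
    where
    open ≤-Reasoning
    instance _ = m*n≢0 2 w
    c : ℕ
    c = threshold d
    expand : ∀ c w → 3 + ((2 * w + 1) + c * (2 * w + 1)) ≡ 2 * w * c + c + 2 * w + 4
    expand = solve-∀
    collect : ∀ c w → 2 * w * c + 2 * w * c + 2 * w + 4 * w ≡ 4 * w * c + 6 * w
    collect = solve-∀

  8K≤2^d : ∀ d K → K ≤ 2 ^ (m * threshold d) → 0 < threshold d → 8 * K ≤ 2 ^ d
  8K≤2^d d K K≤ c>0 = begin
    8 * K                      ≤⟨ *-monoʳ-≤ 8 K≤ ⟩
    2 ^ 3 * 2 ^ (m * c)        ≡⟨ ^-distribˡ-+-* 2 3 (m * c) ⟨
    2 ^ (3 + m * c)            ≤⟨ ^-monoʳ-≤ 2 3+mc≤d ⟩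
    2 ^ d                      ∎
    where
    open ≤-Reasoning
    c : ℕ
    c = threshold d
    cm≤d∸3 : c * m ≤ d ∸ 3
    cm≤d∸3 = threshold*m≤d∸3 d
    3<d : 3 < d
    3<d = m∸n≢0⇒n<m λ d∸3≡0 → <-irrefl refl (≤-trans (*-mono-≤ c>0 (>-nonZero⁻¹ m)) (subst (c * m ≤_) d∸3≡0 cm≤d∸3))
    3+mc≤d : 3 + m * c ≤ d
    3+mc≤d = begin
      3 + m * c          ≡⟨ cong (3 +_) (*-comm m c) ⟩
      3 + c * m          ≤⟨ +-monoʳ-≤ 3 cm≤d∸3 ⟩
      3 + (d ∸ 3)        ≡⟨ m+[n∸m]≡n (<⇒≤ 3<d) ⟩
      d                  ∎

  absorb-half : ∀ c N T K → (0 < c → 8 * K ≤ N) → c * N ≤ T + c * (4 * K) → c * N ≤ 2 * T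
  absorb-half zero    N T K _     _       = z≤n
  absorb-half (suc c) N T K 8K≤N counted = +-cancelʳ-≤ (C * N) (C * N) (2 * T) (begin
    C * N + C * N              ≡⟨ double (C * N) ⟩
    2 * (C * N)                ≤⟨ *-monoʳ-≤ 2 counted ⟩
    2 * (T + C * (4 * K))      ≡⟨ regroup T C K ⟩
    2 * T + C * (8 * K)        ≤⟨ +-monoʳ-≤ (2 * T) (*-monoʳ-≤ C (8K≤N z<s)) ⟩
    2 * T + C * N              ∎)
    where
    open ≤-Reasoning
    C : ℕ
    C = suc c
    double : ∀ x → x + x ≡ 2 * x
    double = solve-∀
    regroup : ∀ T c K → 2 * (T + c * (4 * K)) ≡ 2 * T + c * (8 * K)
    regroup = solve-∀

  information-bound : ∀ d T K → K ≤ 2 ^ (m * threshold d) →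
    threshold d * 2 ^ d ≤ T + threshold d * (4 * K) → d * 2 ^ d ≤ 8 * w * T + 8 * w * 2 ^ d
  information-bound d T K K≤ counted = begin
    d * N                              ≤⟨ *-monoˡ-≤ N (d≤4w*threshold+8w d) ⟩
    (4 * w * c + 8 * w) * N            ≡⟨ distribute w c N ⟩
    4 * w * (c * N) + 8 * w * N
      ≤⟨ +-monoˡ-≤ (8 * w * N) (*-monoʳ-≤ (4 * w) (absorb-half c N T K (8K≤2^d d K K≤) counted)) ⟩
    4 * w * (2 * T) + 8 * w * N        ≡⟨ cong (_+ 8 * w * N) (reassociate w T) ⟩
    8 * w * T + 8 * w * N              ∎
    where
    open ≤-Reasoning
    c N : ℕ
    c = threshold d
    N = 2 ^ d
    distribute : ∀ w c N → (4 * w * c + 8 * w) * N ≡ 4 * w * (c * N) + 8 * w * N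
    distribute = solve-∀
    reassociate : ∀ w T → 4 * w * (2 * T) ≡ 8 * w * T
    reassociate = solve-∀

module StampedExecution (w : ℕ) where

  open import Data.Nat using (_≤_; _<_; _<?_; _≤?_; _+_; z≤n; s≤s)
  open import Data.Nat.Properties using (m≤n⇒m≤1+n; ≮⇒≥; ≰⇒>; <-irrefl; <-≤-trans; ≤-<-trans; ≤-trans; +-identityʳ)
  open import Data.Fin.Properties using (_≟_)
  open import Data.List using (List; []; _∷_; length; filter)
  open import Data.List.Relation.Unary.All using (All; []; _∷_)
  import Data.List.Relation.Unary.All as All
  open import Data.Product using (_×_; _,_; proj₁; proj₂)
  open import Data.Sum using (_⊎_; inj₁; inj₂)
  open import Data.Empty using (⊥-elim)
  open import Relation.Nullary using (Dec; yes; no)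
  open import Relation.Nullary.Decidable using (_×-dec_)
  open FiniteSums using (𝟙; 𝟙-cong; 𝟙-reject; length-filter-partition)
  open import Relation.Binary.PropositionalEquality
  open import Defs using (Word; Mem; write; Prog; out; rd; wr; exec)

  Stamps : Set
  Stamps = Word w → ℕ

  restamp : Stamps → Word w → ℕ → Stamps
  restamp σ a s c with c ≟ a
  ... | yes _ = s
  ... | no  _ = σ c

  record Read : Set where
    constructor read
    field
      cell  : Word w
      value : Word w
      stamp : ℕ

  open Read public

  record Trace (D : Set) : Set where
    constructor trace
    field
      result : D
      memory : Mem w
      stamps : Stamps
      reads  : List Read

  open Trace public

  addRead : ∀ {D} → Read → Trace D → Trace D
  addRead r (trace d m σ rs) = trace d m σ (r ∷ rs)

  traced : ∀ {D} → Prog w D → Mem w → Stamps → ℕ → Trace D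
  traced (out d)    m σ s = trace d m σ []
  traced (rd a k)   m σ s = addRead (read a (m a) (σ a)) (traced (k (m a)) m σ s)
  traced (wr a v p) m σ s = traced p (write w m a v) (restamp σ a s) s

  result-traced : ∀ {D} (p : Prog w D) m σ s → proj₁ (exec p m) ≡ result (traced p m σ s)
  result-traced (out d)    m σ s = refl
  result-traced (rd a k)   m σ s with exec (k (m a)) m | result-traced (k (m a)) m σ s
  ... | _ , _ , _ | eq = eq
  result-traced (wr a v p) m σ s with exec p (write w m a v) | result-traced p (write w m a v) (restamp σ a s) s
  ... | _ , _ , _ | eq = eq

  memory-traced : ∀ {D} (p : Prog w D) m σ s → proj₁ (proj₂ (exec p m)) ≡ memory (traced p m σ s)
  memory-traced (out d)    m σ s = refl
  memory-traced (rd a k)   m σ s with exec (k (m a)) m | memory-traced (k (m a)) m σ s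
  ... | _ , _ , _ | eq = eq
  memory-traced (wr a v p) m σ s with exec p (write w m a v) | memory-traced p (write w m a v) (restamp σ a s) s
  ... | _ , _ , _ | eq = eq

  length-reads≤cost : ∀ {D} (p : Prog w D) m σ s → length (reads (traced p m σ s)) ≤ proj₂ (proj₂ (exec p m))
  length-reads≤cost (out d)    m σ s = z≤n
  length-reads≤cost (rd a k)   m σ s with exec (k (m a)) m | length-reads≤cost (k (m a)) m σ s
  ... | _ , _ , _ | le = s≤s le
  length-reads≤cost (wr a v p) m σ s with exec p (write w m a v) | length-reads≤cost p (write w m a v) (restamp σ a s) s
  ... | _ , _ , _ | le = m≤n⇒m≤1+n le

  Untouched : Mem w → Stamps → Mem w → Stamps → ℕ → Word w → Set
  Untouched m σ m′ σ′ s c = σ′ c ≡ s ⊎ (σ′ c ≡ σ c × m′ c ≡ m c)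

  restamp-write : ∀ m σ a v s c → Untouched m σ (write w m a v) (restamp σ a s) s c
  restamp-write m σ a v s c with c ≟ a
  ... | yes _ = inj₁ refl
  ... | no  _ = inj₂ (refl , refl)

  traced-untouched : ∀ {D} (p : Prog w D) m σ s c →
    Untouched m σ (memory (traced p m σ s)) (stamps (traced p m σ s)) s c
  traced-untouched (out d)    m σ s c = inj₂ (refl , refl)
  traced-untouched (rd a k)   m σ s c = traced-untouched (k (m a)) m σ s c
  traced-untouched (wr a v p) m σ s c
    with traced-untouched p (write w m a v) (restamp σ a s) s c | restamp-write m σ a v s c
  ... | inj₁ eq          | _                  = inj₁ eq
  ... | inj₂ (σ≡ , _)    | inj₁ eq            = inj₁ (trans σ≡ eq)
  ... | inj₂ (σ≡ , m≡)   | inj₂ (σ≡′ , m≡′)   = inj₂ (trans σ≡ σ≡′ , trans m≡ m≡′)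

  ReadsFrom : Mem w → Stamps → ℕ → Read → Set
  ReadsFrom m σ s r = stamp r ≡ s ⊎ (stamp r ≡ σ (cell r) × value r ≡ m (cell r))

  traced-reads : ∀ {D} (p : Prog w D) m σ s → All (ReadsFrom m σ s) (reads (traced p m σ s))
  traced-reads (out d)    m σ s = []
  traced-reads (rd a k)   m σ s = inj₂ (refl , refl) ∷ traced-reads (k (m a)) m σ s
  traced-reads (wr a v p) m σ s = All.map earlier (traced-reads p (write w m a v) (restamp σ a s) s)
    where
    earlier : ∀ {r} → ReadsFrom (write w m a v) (restamp σ a s) s r → ReadsFrom m σ s r
    earlier (inj₁ eq) = inj₁ eq
    earlier {r} (inj₂ (σ≡ , m≡)) with restamp-write m σ a v s (cell r)
    ... | inj₁ eq          = inj₁ (trans σ≡ eq)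
    ... | inj₂ (σ≡′ , m≡′) = inj₂ (trans σ≡ σ≡′ , trans m≡ m≡′)

  -- The operation at time t stamps its writes with t + 1, so InWindow lo hi r says that the
  -- cell read by r was last written at one of the times lo, …, hi - 1.
  InWindow : ℕ → ℕ → Read → Set
  InWindow lo hi r = lo < stamp r × stamp r ≤ hi

  inWindow? : ∀ lo hi r → Dec (InWindow lo hi r)
  inWindow? lo hi r = (lo <? stamp r) ×-dec (stamp r ≤? hi)

  windowCount : ℕ → ℕ → List Read → ℕ
  windowCount lo hi rs = length (filter (inWindow? lo hi) rs)

  𝟙-inWindow-split : ∀ lo mid hi → lo ≤ mid → mid ≤ hi → ∀ r →
    𝟙 (inWindow? lo hi r) ≡ 𝟙 (inWindow? lo mid r) + 𝟙 (inWindow? mid hi r)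
  𝟙-inWindow-split lo mid hi lo≤mid mid≤hi r = by-cases (stamp r ≤? mid)
    where
    open ≡-Reasoning
    whole : Dec (InWindow lo hi r)
    left  : Dec (InWindow lo mid r)
    right : Dec (InWindow mid hi r)
    whole = inWindow? lo hi r
    left  = inWindow? lo mid r
    right = inWindow? mid hi r
    by-cases : Dec (stamp r ≤ mid) → 𝟙 whole ≡ 𝟙 left + 𝟙 right
    by-cases (yes s≤mid) = begin
      𝟙 whole            ≡⟨ 𝟙-cong whole left (λ (lo<s , _) → lo<s , s≤mid) (λ (lo<s , _) → lo<s , ≤-trans s≤mid mid≤hi) ⟩
      𝟙 left             ≡⟨ +-identityʳ _ ⟨
      𝟙 left + 0         ≡⟨ cong (𝟙 left +_) (𝟙-reject right λ (mid<s , _) → <-irrefl refl (<-≤-trans mid<s s≤mid)) ⟨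
      𝟙 left + 𝟙 right   ∎
    by-cases (no s≰mid) = begin
      𝟙 whole
        ≡⟨ 𝟙-cong whole right (λ (_ , s≤hi) → ≰⇒> s≰mid , s≤hi) (λ (mid<s , s≤hi) → ≤-<-trans lo≤mid mid<s , s≤hi) ⟩
      𝟙 right            ≡⟨ cong (_+ 𝟙 right) (𝟙-reject left λ (_ , s≤mid) → s≰mid s≤mid) ⟨
      𝟙 left + 𝟙 right   ∎

  windowCount-split : ∀ lo mid hi → lo ≤ mid → mid ≤ hi → ∀ rs →
    windowCount lo hi rs ≡ windowCount lo mid rs + windowCount mid hi rs
  windowCount-split lo mid hi lo≤mid mid≤hi =
    length-filter-partition (inWindow? lo hi) (inWindow? lo mid) (inWindow? mid hi) (𝟙-inWindow-split lo mid hi lo≤mid mid≤hi)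

  module Replay (b : ℕ) (D : Mem w) where

    Replays : Mem w → Stamps → Mem w → Set
    Replays m σ V = ∀ c → (b < σ c → V c ≡ m c) × (σ c ≤ b → V c ≡ D c)

    SeesD : Read → Set
    SeesD r = stamp r ≤ b → D (cell r) ≡ value r

    replayed-read : ∀ m σ V a → Replays m σ V → SeesD (read a (m a) (σ a)) → V a ≡ m a
    replayed-read m σ V a inv sees with b <? σ a
    ... | yes b<σa = proj₁ (inv a) b<σa
    ... | no  b≮σa = trans (proj₂ (inv a) (≮⇒≥ b≮σa)) (sees (≮⇒≥ b≮σa))

    replay : ∀ {E} (p : Prog w E) m σ V σ′ s s′ → b < s → Replays m σ V →
      All SeesD (reads (traced p m σ s)) →
      result (traced p V σ′ s′) ≡ result (traced p m σ s) ×
      Replays (memory (traced p m σ s)) (stamps (traced p m σ s)) (memory (traced p V σ′ s′))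
    replay (out d)    m σ V σ′ s s′ b<s inv _           = refl , inv
    replay (rd a k)   m σ V σ′ s s′ b<s inv (sees ∷ ok) with V a | replayed-read m σ V a inv sees
    ... | .(m a) | refl = replay (k (m a)) m σ V σ′ s s′ b<s inv ok
    replay (wr a v p) m σ V σ′ s s′ b<s inv ok =
      replay p (write w m a v) (restamp σ a s) (write w V a v) (restamp σ′ a s′) s s′ b<s inv′ ok
      where
      inv′ : Replays (write w m a v) (restamp σ a s) (write w V a v)
      inv′ c with c ≟ a
      ... | yes _ = (λ _ → refl) , (λ s≤b → ⊥-elim (<-irrefl refl (<-≤-trans b<s s≤b)))
      ... | no  _ = inv c

module StampedRun {w q : ℕ} .{{_ : NonZero q}} (A : Algorithm w q) (X : ℕ) where

  open import Data.Nat using (zero; suc; _≤_; z≤n)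
  open import Data.Nat.Properties using (≤-pred; ≤-trans; ≤-reflexive; <-irrefl; m≤n⇒m≤1+n; m≤n⇒m<n∨m≡n)
  open import Data.Fin using (Fin)
  open import Data.List using (List; length)
  open import Data.List.Relation.Unary.All using (All)
  open import Data.List.Membership.Propositional using (_∈_)
  import Data.List.Relation.Unary.All as All
  open import Data.Product using (_×_; _,_)
  open import Data.Sum using (inj₁; inj₂)
  open import Data.Empty using (⊥-elim)
  open import Relation.Binary.PropositionalEquality
  open import Defs using (digit; module Run)
  open StampedExecution w

  open Algorithm A
  open Run A X using (memAt; output; cost)

  stampsAt : ℕ → Stamps
  traceAt  : ℕ → Trace (Fin q)

  stampsAt zero    = λ _ → 0
  stampsAt (suc t) = stamps (traceAt t)

  traceAt t = traced (op (digit q X t)) (memAt t) (stampsAt t) (suc t)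

  readsAt : ℕ → List Read
  readsAt t = reads (traceAt t)

  memAt-suc : ∀ t → memAt (suc t) ≡ memory (traceAt t)
  memAt-suc t = memory-traced (op (digit q X t)) (memAt t) (stampsAt t) (suc t)

  output≡result : ∀ t → output t ≡ result (traceAt t)
  output≡result t = result-traced (op (digit q X t)) (memAt t) (stampsAt t) (suc t)

  length-readsAt≤cost : ∀ t → length (readsAt t) ≤ cost t
  length-readsAt≤cost t = length-reads≤cost (op (digit q X t)) (memAt t) (stampsAt t) (suc t)

  stampsAt≤ : ∀ t c → stampsAt t c ≤ t
  stampsAt≤ zero    c = z≤n
  stampsAt≤ (suc t) c with traced-untouched (op (digit q X t)) (memAt t) (stampsAt t) (suc t) c
  ... | inj₁ eq       = ≤-reflexive eq
  ... | inj₂ (eq , _) = ≤-trans (≤-reflexive eq) (m≤n⇒m≤1+n (stampsAt≤ t c))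

  unchanged-since : ∀ b t → b ≤ t → ∀ c → stampsAt t c ≤ b →
    memAt t c ≡ memAt b c × stampsAt t c ≡ stampsAt b c
  unchanged-since b zero    z≤n c _ = refl , refl
  unchanged-since b (suc t) b≤1+t c σc≤b with m≤n⇒m<n∨m≡n b≤1+t
  ... | inj₂ refl = refl , refl
  ... | inj₁ b<1+t with traced-untouched (op (digit q X t)) (memAt t) (stampsAt t) (suc t) c
  ...   | inj₁ eq = ⊥-elim (<-irrefl refl (≤-trans b<1+t (≤-trans (≤-reflexive (sym eq)) σc≤b)))
  ...   | inj₂ (σ≡ , m≡) with unchanged-since b t (≤-pred b<1+t) c (≤-trans (≤-reflexive (sym σ≡)) σc≤b)
  ...     | m≡′ , σ≡′ = trans (trans (cong (λ M → M c) (memAt-suc t)) m≡) m≡′ , trans σ≡ σ≡′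

  readsAt-earlier : ∀ t → All (λ r → stamp r ≤ t → stamp r ≡ stampsAt t (cell r) × value r ≡ memAt t (cell r)) (readsAt t)
  readsAt-earlier t = All.map earlier (traced-reads (op (digit q X t)) (memAt t) (stampsAt t) (suc t))
    where
    earlier : ∀ {r} → ReadsFrom (memAt t) (stampsAt t) (suc t) r →
      stamp r ≤ t → stamp r ≡ stampsAt t (cell r) × value r ≡ memAt t (cell r)
    earlier (inj₁ eq)     s≤t = ⊥-elim (<-irrefl refl (≤-trans (≤-reflexive (sym eq)) s≤t))
    earlier (inj₂ before) _   = before

  readsAt-before : ∀ b t → b ≤ t → ∀ {r} → r ∈ readsAt t → stamp r ≤ b →
    stamp r ≡ stampsAt b (cell r) × value r ≡ memAt b (cell r)
  readsAt-before b t b≤t {r} r∈ s≤b with All.lookup (readsAt-earlier t) r∈ (≤-trans s≤b b≤t)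
  ... | s≡ , v≡ with unchanged-since b t b≤t (cell r) (subst (_≤ b) s≡ s≤b)
  ...   | m≡ , σ≡ = trans s≡ σ≡ , trans v≡ m≡

module Transcript {w q : ℕ} .{{_ : NonZero q}} (A : Algorithm w q) (a ℓ : ℕ) where

  open import Data.Nat
  open import Data.Nat.Properties
  open import Data.Fin using (Fin)
  open import Data.List using (List; map; filter; length)
  open import Data.List.Properties using (length-map)
  open import Data.List.Relation.Unary.All using (All)
  import Data.List.Relation.Unary.All as All
  open import Data.List.Membership.Propositional using (_∈_)
  open import Data.List.Membership.Propositional.Properties using (∈-map∘filter⁻; ∈-map∘filter⁺)
  open import Data.Product using (_×_; _,_; proj₁; proj₂)
  open import Data.Empty using (⊥-elim)
  open import Relation.Nullary using (yes; no)
  open import Relation.Binary.PropositionalEquality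
  open import Defs using (Word; Mem; digit; exec; module Run)
  open FiniteSums
  open StampedExecution w
  open WordPairLists w using (lookupOr; lookupOr-∈; lookupOr-∉)

  open Algorithm A

  b : ℕ
  b = a + ℓ

  entry : Read → Word w × Word w
  entry r = cell r , value r

  -- The stamps of a replay play no role, hence the dummy values.
  replayMem : (ℕ → Fin q) → Mem w → ℕ → Mem w
  replayMem digits D zero    = D
  replayMem digits D (suc u) = memory (traced (op (digits u)) (replayMem digits D u) (λ _ → 0) 0)

  replayOut : (ℕ → Fin q) → Mem w → ℕ → Fin q
  replayOut digits D u = result (traced (op (digits u)) (replayMem digits D u) (λ _ → 0) 0)

  replayMem-cong : ∀ d₁ d₂ D → (∀ u → u < ℓ → d₁ u ≡ d₂ u) → ∀ u → u ≤ ℓ → replayMem d₁ D u ≡ replayMem d₂ D u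
  replayMem-cong d₁ d₂ D eq zero    _   = refl
  replayMem-cong d₁ d₂ D eq (suc u) u<ℓ =
    cong₂ (λ d M → memory (traced (op d) M (λ _ → 0) 0)) (eq u u<ℓ) (replayMem-cong d₁ d₂ D eq u (<⇒≤ u<ℓ))

  replayOut-cong : ∀ d₁ d₂ D → (∀ u → u < ℓ → d₁ u ≡ d₂ u) → ∀ u → u < ℓ → replayOut d₁ D u ≡ replayOut d₂ D u
  replayOut-cong d₁ d₂ D eq u u<ℓ =
    cong₂ (λ d M → result (traced (op d) M (λ _ → 0) 0)) (eq u u<ℓ) (replayMem-cong d₁ d₂ D eq u (<⇒≤ u<ℓ))

  module _ (X : ℕ) where
    open Run A X using (memAt; output)
    open StampedRun A X

    transcriptAt : ℕ → List (Word w × Word w)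
    transcriptAt t = map entry (filter (inWindow? a b) (readsAt t))

    transcript : List (Word w × Word w)
    transcript = concat< ℓ (λ u → transcriptAt (b + u))

    transfer : ℕ
    transfer = ∑[ u < ℓ ] windowCount a b (readsAt (b + u))

    length-transcript : length transcript ≡ transfer
    length-transcript = trans (length-concat< ℓ _) (∑-cong ℓ λ u _ → length-map entry (filter (inWindow? a b) (readsAt (b + u))))

    -- The memory at time a patched with the transcript: no read of the right half can tell it
    -- apart from the real memory.
    memAtLeft : Mem w
    memAtLeft c = lookupOr c transcript (memAt a c)

    transcript-valid : ∀ {e} → e ∈ transcript → a < stampsAt b (proj₁ e) × proj₂ e ≡ memAt b (proj₁ e)
    transcript-valid e∈ with ∈-concat<⁻ ℓ _ e∈
    ... | u , _ , e∈u with ∈-map∘filter⁻ entry (inWindow? a b) e∈u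
    ...   | r , r∈ , refl , a<s , s≤b with readsAt-before b (b + u) (m≤m+n b u) r∈ s≤b
    ...     | s≡ , v≡ = subst (a <_) s≡ a<s , v≡

    open Replay b memAtLeft

    transcript-functional : ∀ c → All (λ e → proj₁ e ≡ c → proj₂ e ≡ memAt b c) transcript
    transcript-functional c = All.tabulate λ e∈ c≡ → trans (proj₂ (transcript-valid e∈)) (cong (memAt b) c≡)

    readsAt-seesD : ∀ u → u < ℓ → All SeesD (readsAt (b + u))
    readsAt-seesD u u<ℓ = All.tabulate sees
      where
      sees : ∀ {r} → r ∈ readsAt (b + u) → stamp r ≤ b → memAtLeft (cell r) ≡ value r
      sees {r} r∈ s≤b with readsAt-before b (b + u) (m≤m+n b u) r∈ s≤b | a <? stamp r
      ... | _ , v≡ | yes a<s = lookupOr-∈ (cell r) (value r) (memAt a (cell r)) transcript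
                                 (All.map (λ fun c≡ → trans (fun c≡) (sym v≡)) (transcript-functional (cell r)))
                                 (∈-concat<⁺ ℓ _ u u<ℓ (∈-map∘filter⁺ entry (inWindow? a b) (r , r∈ , refl , a<s , s≤b)))
      ... | s≡ , v≡ | no a≮s = trans (lookupOr-∉ (cell r) (memAt a (cell r)) transcript (All.tabulate fresh))
                                 (sym (trans v≡ (proj₁ (unchanged-since a b (m≤m+n a ℓ) (cell r) σb≤a))))
        where
        σb≤a : stampsAt b (cell r) ≤ a
        σb≤a = subst (_≤ a) s≡ (≮⇒≥ a≮s)
        fresh : ∀ {e} → e ∈ transcript → proj₁ e ≢ cell r
        fresh e∈ refl = <-irrefl refl (<-≤-trans (proj₁ (transcript-valid e∈)) σb≤a)

    rightDigits : ℕ → Fin q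
    rightDigits u = digit q X (b + u)

    replayStep : ∀ u → u < ℓ →
      Replays (memAt (b + u)) (stampsAt (b + u)) (replayMem rightDigits memAtLeft u) →
      replayOut rightDigits memAtLeft u ≡ output (b + u) ×
      Replays (memAt (b + suc u)) (stampsAt (b + suc u)) (replayMem rightDigits memAtLeft (suc u))
    replayStep u u<ℓ inv
      with replay (op (rightDigits u)) (memAt (b + u)) (stampsAt (b + u)) (replayMem rightDigits memAtLeft u)
                  (λ _ → 0) (suc (b + u)) 0 (s≤s (m≤m+n b u)) inv (readsAt-seesD u u<ℓ)
    ... | out≡ , inv′ rewrite +-suc b u | memAt-suc (b + u) = trans out≡ (sym (output≡result (b + u))) , inv′

    replays : ∀ u → u ≤ ℓ → Replays (memAt (b + u)) (stampsAt (b + u)) (replayMem rightDigits memAtLeft u)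
    replays zero    _   c = (λ b<σc → ⊥-elim (<-irrefl refl (<-≤-trans b<σc σc≤b))) , (λ _ → refl)
      where
      σc≤b : stampsAt (b + 0) c ≤ b
      σc≤b = subst (stampsAt (b + 0) c ≤_) (+-identityʳ b) (stampsAt≤ (b + 0) c)
    replays (suc u) u<ℓ = proj₂ (replayStep u u<ℓ (replays u (<⇒≤ u<ℓ)))

    output≡replayOut : ∀ u → u < ℓ → output (b + u) ≡ replayOut rightDigits memAtLeft u
    output≡replayOut u u<ℓ = sym (proj₁ (replayStep u u<ℓ (replays u (<⇒≤ u<ℓ))))

  memAt-cong : ∀ X₁ X₂ t → (∀ s → s < t → digit q X₁ s ≡ digit q X₂ s) → Run.memAt A X₁ t ≡ Run.memAt A X₂ t
  memAt-cong X₁ X₂ zero    _  = refl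
  memAt-cong X₁ X₂ (suc t) eq =
    cong₂ (λ d M → proj₁ (proj₂ (exec (op d) M))) (eq t ≤-refl) (memAt-cong X₁ X₂ t λ s s<t → eq s (m≤n⇒m≤1+n s<t))

  decode : ∀ X₁ X₂ → (∀ t → t < a → digit q X₁ t ≡ digit q X₂ t) → transcript X₁ ≡ transcript X₂ →
    (∀ u → u < ℓ → digit q X₁ (b + u) ≡ digit q X₂ (b + u)) →
    ∀ u → u < ℓ → Run.output A X₁ (b + u) ≡ Run.output A X₂ (b + u)
  decode X₁ X₂ left≡ transcript≡ right≡ u u<ℓ = begin
    Run.output A X₁ (b + u)                          ≡⟨ output≡replayOut X₁ u u<ℓ ⟩
    replayOut (rightDigits X₁) (memAtLeft X₁) u      ≡⟨ cong (λ D → replayOut (rightDigits X₁) D u) memAtLeft≡ ⟩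
    replayOut (rightDigits X₁) (memAtLeft X₂) u
      ≡⟨ replayOut-cong (rightDigits X₁) (rightDigits X₂) (memAtLeft X₂) right≡ u u<ℓ ⟩
    replayOut (rightDigits X₂) (memAtLeft X₂) u      ≡⟨ output≡replayOut X₂ u u<ℓ ⟨
    Run.output A X₂ (b + u)                          ∎
    where
    open ≡-Reasoning
    memAtLeft≡ : memAtLeft X₁ ≡ memAtLeft X₂
    memAtLeft≡ = cong₂ (λ l M c → lookupOr c l (M c)) transcript≡ (memAt-cong X₁ X₂ a left≡)

module NodeBound (w δ n Y : ℕ) .{{_ : NonZero w}} (Y<q^n : Y < base δ ^ n)
                 (A : Algorithm w (base δ)) (solves : Solves (base δ) {{base≢0 δ}} A n Y) where

  open import Data.Nat
  open import Data.Nat.Properties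
  open import Data.Product using (_×_; _,_; proj₁; proj₂)
  open import Function using (_∘_)
  open import Relation.Nullary using (Dec; yes; no)
  open import Relation.Nullary.Decidable using (decidable-stable; ¬¬-excluded-middle)
  open import Relation.Binary.PropositionalEquality
  open import Data.Nat.Tactic.RingSolver using (solve-∀)
  open import Defs using (digit; digits; Zseg; Retrorse; IsI; module Run)
  open FiniteSums
  open Digits
  open WordPairLists w using (listCode; listCode-injective; listCode<; radix; radix≤2^[2w+1])
  open InformationArithmetic w using (threshold; information-bound)

  q : ℕ
  q = base δ

  instance
    q≢0 : NonZero q
    q≢0 = base≢0 δ

  module _ (a ℓ : ℕ) (fits : a + 2 * ℓ ≤ n) where

    open Transcript A a ℓ using (b; transcript; transfer; decode; length-transcript)

    r : ℕ
    r = n ∸ (a + ℓ)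

    n≡a+ℓ+r : n ≡ a + (ℓ + r)
    n≡a+ℓ+r = trans (sym (m+[n∸m]≡n (≤-trans (+-monoʳ-≤ a (m≤m+n ℓ (ℓ + 0))) fits))) (+-assoc a ℓ r)

    q^n≡ : q ^ n ≡ q ^ a * (q ^ ℓ * q ^ r)
    q^n≡ = trans (cong (q ^_) n≡a+ℓ+r) (trans (^-distribˡ-+-* q a (ℓ + r)) (cong (q ^ a *_) (^-distribˡ-+-* q ℓ r)))

    splice : ℕ → ℕ → ℕ → ℕ
    splice lo hi x = lo + q ^ a * x + q ^ (a + ℓ) * hi

    splice≡ : ∀ lo hi x → splice lo hi x ≡ lo + q ^ a * (x + q ^ ℓ * hi)
    splice≡ lo hi x = trans (cong (λ z → lo + q ^ a * x + z * hi) (^-distribˡ-+-* q a ℓ)) (regroup (q ^ a) (q ^ ℓ) lo x hi)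
      where
      regroup : ∀ A L lo x hi → lo + A * x + A * L * hi ≡ lo + A * (x + L * hi)
      regroup = solve-∀

    splice< : ∀ lo hi x → lo < q ^ a → hi < q ^ r → x < q ^ ℓ → splice lo hi x < q ^ n
    splice< lo hi x lo< hi< x< = subst₂ _<_ (sym (splice≡ lo hi x)) (sym q^n≡)
      (mixed-radix-< (q ^ a) (q ^ ℓ * q ^ r) lo (x + q ^ ℓ * hi) lo< (mixed-radix-< (q ^ ℓ) (q ^ r) x hi x< hi<))

    digit-splice-low : ∀ lo hi x t → t < a → digit q (splice lo hi x) t ≡ digit q lo t
    digit-splice-low lo hi x t t<a = trans (cong (λ z → digit q z t) (splice≡ lo hi x)) (digit-low q lo (x + q ^ ℓ * hi) a t t<a)

    digit-splice-high : ∀ lo hi x u → lo < q ^ a → x < q ^ ℓ → digit q (splice lo hi x) (b + u) ≡ digit q hi u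
    digit-splice-high lo hi x u lo< x< = begin
      digit q (splice lo hi x) (a + ℓ + u)                       ≡⟨ cong₂ (digit q) (splice≡ lo hi x) (+-assoc a ℓ u) ⟩
      digit q (lo + q ^ a * (x + q ^ ℓ * hi)) (a + (ℓ + u))      ≡⟨ digit-high q lo (x + q ^ ℓ * hi) a (ℓ + u) lo< ⟩
      digit q (x + q ^ ℓ * hi) (ℓ + u)                           ≡⟨ digit-high q x hi ℓ u x< ⟩
      digit q hi u                                               ∎
      where open ≡-Reasoning

    ∑-splice : ∀ (f : ℕ → ℕ) → ∑< (q ^ n) f ≡ ∑[ hi < q ^ r ] ∑[ lo < q ^ a ] ∑[ x < q ^ ℓ ] f (splice lo hi x)
    ∑-splice f = begin
      ∑< (q ^ n) f                                                                 ≡⟨ cong (λ N → ∑< N f) q^n≡ ⟩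
      ∑< (q ^ a * (q ^ ℓ * q ^ r)) f                                               ≡⟨ ∑-range-* (q ^ a) (q ^ ℓ * q ^ r) f ⟩
      ∑[ y < q ^ ℓ * q ^ r ] ∑[ lo < q ^ a ] f (q ^ a * y + lo)                    ≡⟨ ∑-range-* (q ^ ℓ) (q ^ r) _ ⟩
      ∑[ hi < q ^ r ] ∑[ x < q ^ ℓ ] ∑[ lo < q ^ a ] f (q ^ a * (q ^ ℓ * hi + x) + lo)
                                                                                   ≡⟨ ∑-cong (q ^ r) (λ hi _ → ∑-comm (q ^ ℓ) (q ^ a) _) ⟩
      ∑[ hi < q ^ r ] ∑[ lo < q ^ a ] ∑[ x < q ^ ℓ ] f (q ^ a * (q ^ ℓ * hi + x) + lo)
                                                                                   ≡⟨ ∑-cong (q ^ r) (λ hi _ → ∑-cong (q ^ a) λ lo _ → ∑-cong (q ^ ℓ) λ x _ → cong f (reorder lo hi x)) ⟩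
      ∑[ hi < q ^ r ] ∑[ lo < q ^ a ] ∑[ x < q ^ ℓ ] f (splice lo hi x)            ∎
      where
      open ≡-Reasoning
      commute : ∀ A L lo hi x → A * (L * hi + x) + lo ≡ lo + A * (x + L * hi)
      commute = solve-∀
      reorder : ∀ lo hi x → q ^ a * (q ^ ℓ * hi + x) + lo ≡ splice lo hi x
      reorder lo hi x = trans (commute (q ^ a) (q ^ ℓ) lo hi x) (sym (splice≡ lo hi x))

    ∑-splice-mono : ∀ (f g : ℕ → ℕ) →
      (∀ lo hi → lo < q ^ a → hi < q ^ r → ∑[ x < q ^ ℓ ] f (splice lo hi x) ≤ ∑[ x < q ^ ℓ ] g (splice lo hi x)) →
      ∑< (q ^ n) f ≤ ∑< (q ^ n) g
    ∑-splice-mono f g le = begin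
      ∑< (q ^ n) f                                                        ≡⟨ ∑-splice f ⟩
      ∑[ hi < q ^ r ] ∑[ lo < q ^ a ] ∑[ x < q ^ ℓ ] f (splice lo hi x)
        ≤⟨ ∑-mono-≤ (q ^ r) (λ hi hi< → ∑-mono-≤ (q ^ a) λ lo lo< → le lo hi lo< hi<) ⟩
      ∑[ hi < q ^ r ] ∑[ lo < q ^ a ] ∑[ x < q ^ ℓ ] g (splice lo hi x)   ≡⟨ ∑-splice g ⟨
      ∑< (q ^ n) g                                                        ∎
      where open ≤-Reasoning

    Yhigh : ℕ
    Yhigh = (Y / q ^ (2 * ℓ)) {{m^n≢0 q (2 * ℓ)}}

    Zseg≡ : ∀ lo hi x → Zseg q Y ℓ a lo hi Yhigh x ≡ digits q (splice lo hi x * Y) b ℓ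
    Zseg≡ lo hi x = cong (λ y → digits q (splice lo hi x * y) b ℓ) (digits-low+high q Y (2 * ℓ))

    b+u<n : ∀ u → u < ℓ → b + u < n
    b+u<n u u<ℓ = begin-strict
      a + ℓ + u        <⟨ +-monoʳ-< (a + ℓ) u<ℓ ⟩
      a + ℓ + ℓ        ≡⟨ trans (+-assoc a ℓ ℓ) (cong (λ z → a + (ℓ + z)) (sym (+-identityʳ ℓ))) ⟩
      a + 2 * ℓ        ≤⟨ fits ⟩
      n                ∎
      where open ≤-Reasoning

    transcript-determines-Zseg : ∀ lo hi → lo < q ^ a → hi < q ^ r → ∀ x y → x < q ^ ℓ → y < q ^ ℓ →
      transcript (splice lo hi x) ≡ transcript (splice lo hi y) →
      Zseg q Y ℓ a lo hi Yhigh x ≡ Zseg q Y ℓ a lo hi Yhigh y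
    transcript-determines-Zseg lo hi lo< hi< x y x< y< transcript≡ = begin
      Zseg q Y ℓ a lo hi Yhigh x    ≡⟨ Zseg≡ lo hi x ⟩
      digits q (X₁ * Y) b ℓ          ≡⟨ digits-cong q (X₁ * Y) (X₂ * Y) b ℓ product-digit≡ ⟩
      digits q (X₂ * Y) b ℓ          ≡⟨ Zseg≡ lo hi y ⟨
      Zseg q Y ℓ a lo hi Yhigh y    ∎
      where
      open ≡-Reasoning
      X₁ X₂ : ℕ
      X₁ = splice lo hi x
      X₂ = splice lo hi y
      output≡ : ∀ u → u < ℓ → Run.output A X₁ (b + u) ≡ Run.output A X₂ (b + u)
      output≡ = decode X₁ X₂
        (λ t t<a → trans (digit-splice-low lo hi x t t<a) (sym (digit-splice-low lo hi y t t<a)))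
        transcript≡
        (λ u _ → trans (digit-splice-high lo hi x u lo< x<) (sym (digit-splice-high lo hi y u lo< y<)))
      product-digit≡ : ∀ u → u < ℓ → digit q (X₁ * Y) (b + u) ≡ digit q (X₂ * Y) (b + u)
      product-digit≡ u u<ℓ = begin
        digit q (X₁ * Y) (b + u)      ≡⟨ solves X₁ (splice< lo hi x lo< hi< x<) (b + u) (b+u<n u u<ℓ) ⟨
        Run.output A X₁ (b + u)       ≡⟨ output≡ u u<ℓ ⟩
        Run.output A X₂ (b + u)       ≡⟨ solves X₂ (splice< lo hi y lo< hi< y<) (b + u) (b+u<n u u<ℓ) ⟩
        digit q (X₂ * Y) (b + u)      ∎

    -- With lo and hi fixed, the transcript code of x determines Z', which Y' retrorse repeats at
    -- most four times; hence at most 4 K inputs x have fewer than c transcript reads.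
    context-bound : Retrorse q n Y ℓ → ∀ lo hi → lo < q ^ a → hi < q ^ r →
      ∑[ x < q ^ ℓ ] (δ * ℓ) ≤ ∑[ x < q ^ ℓ ] (8 * w * transfer (splice lo hi x) + 8 * w)
    context-bound retrorse lo hi lo< hi< = begin
      ∑[ x < N ] (δ * ℓ)
        ≡⟨ trans (∑-const N (δ * ℓ)) (*-comm N (δ * ℓ)) ⟩
      δ * ℓ * N
        ≡⟨ cong (δ * ℓ *_) N≡2^δℓ ⟩
      δ * ℓ * 2 ^ (δ * ℓ)
        ≤⟨ information-bound (δ * ℓ) T K K≤ (subst (λ M → c * M ≤ T + c * (4 * K)) N≡2^δℓ counted) ⟩
      8 * w * T + 8 * w * 2 ^ (δ * ℓ)
        ≡⟨ cong₂ _+_ (∑-*-distribˡ N (8 * w) _) (trans (*-comm N (8 * w)) (cong (8 * w *_) N≡2^δℓ)) ⟨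
      ∑[ x < N ] (8 * w * transfer (X x)) + N * (8 * w)
        ≡⟨ cong (∑[ x < N ] (8 * w * transfer (X x)) +_) (∑-const N (8 * w)) ⟨
      ∑[ x < N ] (8 * w * transfer (X x)) + ∑[ x < N ] (8 * w)
        ≡⟨ ∑-distrib-+ N _ _ ⟨
      ∑[ x < N ] (8 * w * transfer (X x) + 8 * w)
        ∎
      where
      open ≤-Reasoning
      N : ℕ
      N = q ^ ℓ
      N≡2^δℓ : N ≡ 2 ^ (δ * ℓ)
      N≡2^δℓ = ^-*-assoc 2 δ ℓ
      X : ℕ → ℕ
      X = splice lo hi
      T c K : ℕ
      T = ∑[ x < N ] transfer (X x)
      c = threshold (δ * ℓ)
      K = radix ^ c
      K≤ : K ≤ 2 ^ ((2 * w + 1) * c)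
      K≤ = ≤-trans (^-monoˡ-≤ c radix≤2^[2w+1]) (≤-reflexive (^-*-assoc 2 (2 * w + 1) c))
      code : ℕ → ℕ
      code x = listCode (transcript (X x))
      Zseg-fibres : ∀ z → ∑[ x < N ] 𝟙 (Zseg q Y ℓ a lo hi Yhigh x ≟ z) ≤ 4
      Zseg-fibres z = subst (_≤ 4) (length-filter-applyUpTo (λ x → Zseg q Y ℓ a lo hi Yhigh x ≟ z) N (λ x → x))
        (retrorse a fits lo lo< hi hi< Yhigh (high-part-< q Y n (2 * ℓ) (≤-trans (m≤n+m (2 * ℓ) a) fits) Y<q^n) z)
      code-fibres : ∀ z → ∑[ x < N ] 𝟙 (code x ≟ z) ≤ 4
      code-fibres = fibres-≤-factor N 4 code (Zseg q Y ℓ a lo hi Yhigh)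
        (λ x y x< y< code≡ → transcript-determines-Zseg lo hi lo< hi< x y x< y< (listCode-injective _ _ code≡)) Zseg-fibres
      short⇒small-code : ∀ x → x < N → transfer (X x) < c → code x < K
      short⇒small-code x _ short = listCode< c (transcript (X x)) (≤-trans (≤-reflexive (length-transcript (X x))) (<⇒≤ short))
      counted : c * N ≤ T + c * (4 * K)
      counted = ∑-threshold N c K (4 * K) (transfer ∘ X) code short⇒small-code (count-below-≤ N 4 K code code-fibres)

    retrorse-node-bound : Retrorse q n Y ℓ → δ * ℓ * q ^ n ≤ 8 * w * ∑< (q ^ n) transfer + 8 * w * q ^ n
    retrorse-node-bound retrorse = begin
      δ * ℓ * q ^ n                                   ≡⟨ trans (∑-const (q ^ n) (δ * ℓ)) (*-comm (q ^ n) (δ * ℓ)) ⟨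
      ∑[ _ < q ^ n ] (δ * ℓ)                          ≤⟨ ∑-splice-mono _ _ (context-bound retrorse) ⟩
      ∑[ X < q ^ n ] (8 * w * transfer X + 8 * w)     ≡⟨ ∑-distrib-+ (q ^ n) _ _ ⟩
      ∑[ X < q ^ n ] (8 * w * transfer X) + ∑[ _ < q ^ n ] (8 * w)
                                                      ≡⟨ cong₂ _+_ (∑-*-distribˡ (q ^ n) (8 * w) transfer) (trans (∑-const (q ^ n) (8 * w)) (*-comm (q ^ n) (8 * w))) ⟩
      8 * w * ∑< (q ^ n) transfer + 8 * w * q ^ n     ∎
      where open ≤-Reasoning

    -- Retrorse need not be decidable, but the goal is a decidable, hence ¬¬-stable, inequality.
    node-bound : (I : ℕ → ℕ) → IsI q n Y I → δ * I ℓ * q ^ n ≤ 8 * w * ∑< (q ^ n) transfer + 8 * w * q ^ n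
    node-bound I isI = decidable-stable (_ ≤? _) λ ¬bound → ¬¬-excluded-middle (¬bound ∘ by-cases)
      where
      by-cases : Dec (Retrorse q n Y ℓ) → δ * I ℓ * q ^ n ≤ 8 * w * ∑< (q ^ n) transfer + 8 * w * q ^ n
      by-cases (yes retrorse) rewrite proj₁ (isI ℓ) retrorse = retrorse-node-bound retrorse
      by-cases (no ¬retrorse) rewrite proj₂ (isI ℓ) ¬retrorse | *-zeroʳ δ = z≤n

module TreeBound (w δ n Y : ℕ) .{{_ : NonZero w}} (Y<q^n : Y < base δ ^ n)
                 (A : Algorithm w (base δ)) (solves : Solves (base δ) {{base≢0 δ}} A n Y)
                 (I : ℕ → ℕ) (isI : IsI (base δ) {{base≢0 δ}} n Y I) where

  open import Data.Nat
  open import Data.Nat.Properties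
  open import Data.List using (List)
  open import Data.List.Properties using (length-filter)
  open import Relation.Binary.PropositionalEquality
  open import Data.Nat.Tactic.RingSolver using (solve-∀)
  open import Defs using (balanced; leaves; sumInternal; module Run)
  open FiniteSums
  open StampedExecution w using (Read; windowCount; windowCount-split)
  open NodeBound w δ n Y Y<q^n A solves using (q; q≢0; node-bound)

  readsAt : ℕ → ℕ → List Read
  readsAt X = StampedRun.readsAt A X

  withinBlock : ℕ → ℕ → ℕ → ℕ
  withinBlock X a len = ∑[ u < len ] windowCount a (a + u) (readsAt X (a + u))

  withinBlock-split : ∀ X a ℓ → withinBlock X a (ℓ + ℓ) ≡ withinBlock X a ℓ + withinBlock X (a + ℓ) ℓ + Transcript.transfer A a ℓ X
  withinBlock-split X a ℓ = begin
    withinBlock X a (ℓ + ℓ)                                              ≡⟨ ∑-split ℓ ℓ _ ⟩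
    withinBlock X a ℓ + ∑[ u < ℓ ] windowCount a (a + (ℓ + u)) (readsAt X (a + (ℓ + u)))
                                                                         ≡⟨ cong (withinBlock X a ℓ +_) (∑-cong ℓ λ u _ → split u) ⟩
    withinBlock X a ℓ + ∑[ u < ℓ ] (transferAt u + windowCount (a + ℓ) (a + ℓ + u) (readsAt X (a + ℓ + u)))
                                                                         ≡⟨ cong (withinBlock X a ℓ +_) (∑-distrib-+ ℓ _ _) ⟩
    withinBlock X a ℓ + (Transcript.transfer A a ℓ X + withinBlock X (a + ℓ) ℓ)
                                                                         ≡⟨ swap (withinBlock X a ℓ) _ _ ⟩
    withinBlock X a ℓ + withinBlock X (a + ℓ) ℓ + Transcript.transfer A a ℓ X ∎
    where
    open ≡-Reasoning
    transferAt : ℕ → ℕ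
    transferAt u = windowCount a (a + ℓ) (readsAt X (a + ℓ + u))
    split : ∀ u → windowCount a (a + (ℓ + u)) (readsAt X (a + (ℓ + u)))
                ≡ transferAt u + windowCount (a + ℓ) (a + ℓ + u) (readsAt X (a + ℓ + u))
    split u rewrite sym (+-assoc a ℓ u) = windowCount-split a (a + ℓ) (a + ℓ + u) (m≤m+n a ℓ) (m≤m+n (a + ℓ) u) (readsAt X (a + ℓ + u))
    swap : ∀ x y z → x + (y + z) ≡ x + z + y
    swap = solve-∀

  leaves-balanced : ∀ k → leaves (balanced k) ≡ 2 ^ k
  leaves-balanced zero    = refl
  leaves-balanced (suc k) = trans (cong₂ _+_ (leaves-balanced k) (leaves-balanced k)) (cong (2 ^ k +_) (sym (+-identityʳ (2 ^ k))))

  Qn : ℕ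
  Qn = q ^ n

  ∑-withinBlock-split : ∀ a ℓ → ∑[ X < Qn ] withinBlock X a (ℓ + ℓ)
    ≡ ∑[ X < Qn ] withinBlock X a ℓ + ∑[ X < Qn ] withinBlock X (a + ℓ) ℓ + ∑[ X < Qn ] Transcript.transfer A a ℓ X
  ∑-withinBlock-split a ℓ = trans (∑-cong Qn λ X _ → withinBlock-split X a ℓ)
    (trans (∑-distrib-+ Qn _ _) (cong (_+ ∑[ X < Qn ] Transcript.transfer A a ℓ X) (∑-distrib-+ Qn _ _)))

  -- A subtree with 2^k leaves has 2^k - 1 internal nodes; the extra 8w q^n on the left avoids
  -- the subtraction.
  tree-bound : ∀ k a → a + 2 ^ k ≤ n →
    δ * sumInternal I (balanced k) * Qn + 8 * w * Qn ≤ 8 * w * ∑[ X < Qn ] withinBlock X a (2 ^ k) + 8 * w * Qn * 2 ^ k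
  tree-bound zero    a _    rewrite *-zeroʳ δ | *-identityʳ (8 * w * Qn) = m≤n+m (8 * w * Qn) _
  tree-bound (suc k) a fits = +-cancelʳ-≤ (W * Qn) _ _ (begin
    δ * (i + s + s) * Qn + W * Qn + W * Qn                  ≡⟨ spread δ i s Qn W ⟩
    (δ * s * Qn + W * Qn) + (δ * s * Qn + W * Qn) + δ * i * Qn
                                                            ≤⟨ +-mono-≤ (+-mono-≤ (tree-bound k a fitsˡ) (tree-bound k (a + ℓ) fitsʳ)) root ⟩
    (W * ΣL + W * Qn * ℓ) + (W * ΣR + W * Qn * ℓ) + (W * ΣT + W * Qn)
                                                            ≡⟨ collect W ΣL ΣR ΣT Qn ℓ ⟩
    W * (ΣL + ΣR + ΣT) + W * Qn * (ℓ + (ℓ + 0)) + W * Qn    ≡⟨ cong (λ z → W * z + W * Qn * (ℓ + (ℓ + 0)) + W * Qn) Σ≡ ⟨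
    W * ∑[ X < Qn ] withinBlock X a (ℓ + (ℓ + 0)) + W * Qn * (ℓ + (ℓ + 0)) + W * Qn ∎)
    where
    open ≤-Reasoning
    W ℓ s i ΣL ΣR ΣT : ℕ
    W = 8 * w
    ℓ = 2 ^ k
    s = sumInternal I (balanced k)
    i = I (leaves (balanced k))
    ΣL = ∑[ X < Qn ] withinBlock X a ℓ
    ΣR = ∑[ X < Qn ] withinBlock X (a + ℓ) ℓ
    ΣT = ∑[ X < Qn ] Transcript.transfer A a ℓ X
    Σ≡ : ∑[ X < Qn ] withinBlock X a (ℓ + (ℓ + 0)) ≡ ΣL + ΣR + ΣT
    Σ≡ = trans (cong (λ m → ∑[ X < Qn ] withinBlock X a (ℓ + m)) (+-identityʳ ℓ)) (∑-withinBlock-split a ℓ)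
    fitsˡ : a + ℓ ≤ n
    fitsˡ = ≤-trans (+-monoʳ-≤ a (m≤m+n ℓ (ℓ + 0))) fits
    fitsʳ : a + ℓ + ℓ ≤ n
    fitsʳ = ≤-trans (≤-reflexive (trans (+-assoc a ℓ ℓ) (cong (λ z → a + (ℓ + z)) (sym (+-identityʳ ℓ))))) fits
    root : δ * i * Qn ≤ W * ΣT + W * Qn
    root rewrite leaves-balanced k = node-bound a ℓ fits I isI
    spread : ∀ δ i s Qn W → δ * (i + s + s) * Qn + W * Qn + W * Qn ≡ (δ * s * Qn + W * Qn) + (δ * s * Qn + W * Qn) + δ * i * Qn
    spread = solve-∀
    collect : ∀ W ΣL ΣR ΣT Qn ℓ → (W * ΣL + W * Qn * ℓ) + (W * ΣR + W * Qn * ℓ) + (W * ΣT + W * Qn)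
                                   ≡ W * (ΣL + ΣR + ΣT) + W * Qn * (ℓ + (ℓ + 0)) + W * Qn
    collect = solve-∀

  withinBlock≤totalTime : ∀ X → withinBlock X 0 n ≤ Run.totalTime A X n
  withinBlock≤totalTime X = begin
    withinBlock X 0 n
      ≤⟨ ∑-mono-≤ n (λ u _ → ≤-trans (length-filter _ (readsAt X u)) (StampedRun.length-readsAt≤cost A X u)) ⟩
    ∑< n (Run.cost A X)             ≡⟨ sum-map-upTo n (Run.cost A X) ⟨
    Run.totalTime A X n             ∎
    where open ≤-Reasoning

  time-bound : ∀ k → n ≡ 2 ^ k →
    δ * sumInternal I (balanced k) * Qn ≤ ∑[ X < Qn ] Run.totalTime A X n * (8 * w) + (n ∸ 1) * Qn * (8 * w)
  time-bound k refl = +-cancelʳ-≤ (W * Qn) _ _ (begin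
    δ * sumInternal I (balanced k) * Qn + W * Qn         ≤⟨ tree-bound k 0 ≤-refl ⟩
    W * ∑[ X < Qn ] withinBlock X 0 n + W * Qn * n
      ≤⟨ +-monoˡ-≤ (W * Qn * n) (*-monoʳ-≤ W (∑-mono-≤ Qn λ X _ → withinBlock≤totalTime X)) ⟩
    W * T + W * Qn * n                                   ≡⟨ cong (λ m → W * T + W * Qn * m) (suc-pred n {{m^n≢0 2 k}}) ⟨
    W * T + W * Qn * suc (n ∸ 1)                         ≡⟨ regroup W Qn T (n ∸ 1) ⟩
    T * W + (n ∸ 1) * Qn * W + W * Qn                    ∎)
    where
    open ≤-Reasoning
    W T : ℕ
    W = 8 * w
    T = ∑[ X < Qn ] Run.totalTime A X n
    regroup : ∀ W Q T m → W * T + W * Q * suc m ≡ T * W + m * Q * W + W * Q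
    regroup = solve-∀

module RationalBound where

  open import Data.Nat as ℕ using (ℕ; suc; NonZero)
  import Data.Nat.Properties as ℕ
  open import Data.Integer as ℤ using (+_; +≤+)
  import Data.Integer.Properties as ℤ
  open import Data.Rational as ℚ using (ℚ; _/_; toℚᵘ)
  import Data.Rational.Properties as ℚ
  open import Data.Rational.Unnormalised as ℚᵘ using (mkℚᵘ; *≤*)
  import Data.Rational.Unnormalised.Properties as ℚᵘ
  open import Relation.Binary.PropositionalEquality
  open import Data.Nat.Tactic.RingSolver using (solve-∀)

  toℚᵘ-/ : ∀ a b → toℚᵘ (+ a / suc b) ℚᵘ.≃ mkℚᵘ (+ a) b
  toℚᵘ-/ a b = ℚ.toℚᵘ-fromℚᵘ (mkℚᵘ (+ a) b)

  /-*-≤-/-+ : ∀ δ s t m d e → δ ℕ.* s ℕ.* suc e ℕ.≤ t ℕ.* suc d ℕ.+ m ℕ.* suc e ℕ.* suc d →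
    (+ δ / suc d) ℚ.* (+ s / 1) ℚ.≤ (+ t / suc e) ℚ.+ (+ m / 1)
  /-*-≤-/-+ δ s t m d e le = ℚ.toℚᵘ-cancel-≤ (ℚᵘ.≤-respʳ-≃ (ℚᵘ.≃-sym rhs≃) (ℚᵘ.≤-respˡ-≃ (ℚᵘ.≃-sym lhs≃) unnormalised))
    where
    lhs≃ : toℚᵘ ((+ δ / suc d) ℚ.* (+ s / 1)) ℚᵘ.≃ mkℚᵘ (+ δ) d ℚᵘ.* mkℚᵘ (+ s) 0
    lhs≃ = ℚᵘ.≃-trans (ℚ.toℚᵘ-homo-* (+ δ / suc d) (+ s / 1)) (ℚᵘ.*-cong (toℚᵘ-/ δ d) (toℚᵘ-/ s 0))
    rhs≃ : toℚᵘ ((+ t / suc e) ℚ.+ (+ m / 1)) ℚᵘ.≃ mkℚᵘ (+ t) e ℚᵘ.+ mkℚᵘ (+ m) 0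
    rhs≃ = ℚᵘ.≃-trans (ℚ.toℚᵘ-homo-+ (+ t / suc e) (+ m / 1)) (ℚᵘ.+-cong (toℚᵘ-/ t e) (toℚᵘ-/ m 0))
    reshape-lhs : ∀ δ s e → δ ℕ.* s ℕ.* suc e ≡ δ ℕ.* s ℕ.* (suc e ℕ.* 1)
    reshape-lhs = solve-∀
    reshape-rhs : ∀ t m e d → t ℕ.* suc d ℕ.+ m ℕ.* suc e ℕ.* suc d ≡ (t ℕ.* 1 ℕ.+ m ℕ.* suc e) ℕ.* (suc d ℕ.* 1)
    reshape-rhs = solve-∀
    lhsℤ : + (δ ℕ.* s ℕ.* (suc e ℕ.* 1)) ≡ (+ δ ℤ.* + s) ℤ.* + (suc e ℕ.* 1)
    lhsℤ = trans (ℤ.pos-* (δ ℕ.* s) _) (cong (ℤ._* + (suc e ℕ.* 1)) (ℤ.pos-* δ s))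
    rhsℤ : + ((t ℕ.* 1 ℕ.+ m ℕ.* suc e) ℕ.* (suc d ℕ.* 1)) ≡ (+ t ℤ.* + 1 ℤ.+ + m ℤ.* + suc e) ℤ.* + (suc d ℕ.* 1)
    rhsℤ = trans (ℤ.pos-* (t ℕ.* 1 ℕ.+ m ℕ.* suc e) _)
      (cong (ℤ._* + (suc d ℕ.* 1)) (trans (ℤ.pos-+ (t ℕ.* 1) _) (cong₂ ℤ._+_ (ℤ.pos-* t 1) (ℤ.pos-* m (suc e)))))
    unnormalised : (mkℚᵘ (+ δ) d) ℚᵘ.* (mkℚᵘ (+ s) 0) ℚᵘ.≤ (mkℚᵘ (+ t) e) ℚᵘ.+ (mkℚᵘ (+ m) 0)
    unnormalised = *≤* (subst₂ ℤ._≤_ lhsℤ rhsℤ (+≤+ (subst₂ ℕ._≤_ (reshape-lhs δ s e) (reshape-rhs t m e d) le)))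

  p≤q+r⇒p-r≤q : ∀ p q r → p ℚ.≤ q ℚ.+ r → p ℚ.- r ℚ.≤ q
  p≤q+r⇒p-r≤q p q r le = ℚ.≤-trans (ℚ.+-monoˡ-≤ (ℚ.- r) le)
    (ℚ.≤-reflexive (trans (ℚ.+-assoc q r (ℚ.- r)) (trans (cong (q ℚ.+_) (ℚ.+-inverseʳ r)) (ℚ.+-identityʳ q))))

  scaled-bound : ∀ δ s t m D Q .{{_ : NonZero D}} .{{_ : NonZero Q}} →
    δ ℕ.* s ℕ.* Q ℕ.≤ t ℕ.* D ℕ.+ m ℕ.* Q ℕ.* D →
    (+ δ / D) ℚ.* (+ s / 1) ℚ.- (+ m / 1) ℚ.≤ + t / Q
  scaled-bound δ s t m D Q le = p≤q+r⇒p-r≤q _ _ _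
    (subst₂ (λ x y → x ℚ.* (+ s / 1) ℚ.≤ y ℚ.+ (+ m / 1)) (/-suc-pred {δ} D) (/-suc-pred {t} Q)
      (/-*-≤-/-+ δ s t m (ℕ.pred D) (ℕ.pred Q)
        (subst₂ (λ D′ Q′ → δ ℕ.* s ℕ.* Q′ ℕ.≤ t ℕ.* D′ ℕ.+ m ℕ.* Q′ ℕ.* D′) (sym (ℕ.suc-pred D)) (sym (ℕ.suc-pred Q)) le)))
    where
    /-suc-pred : ∀ {a} N .{{_ : NonZero N}} → + a / suc (ℕ.pred N) ≡ + a / N
    /-suc-pred {a} N = ℚ./-cong {+ a} {suc (ℕ.pred N)} refl (ℕ.suc-pred N)

open import Defs using (sumInternal; balanced; bound; expectedTime; module Run)
open import Data.Rational using (_≤_)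
import Data.Nat as ℕ
open import Data.Nat.Properties using (m*n≢0; m^n≢0)
open import Data.List using (map; upTo)
open import Data.Nat.ListAction using (sum)
open import Relation.Binary.PropositionalEquality using (refl; sym; subst)
open FiniteSums using (sum-map-upTo)
open RationalBound using (scaled-bound)

lemma8 : (k j w : ℕ) .{{_ : NonZero w}} →
    (Y : ℕ) → Y < base (2 ^ j) ^ (2 ^ k) →
    (I : ℕ → ℕ) → IsI (base (2 ^ j)) {{base≢0 (2 ^ j)}} (2 ^ k) Y I →
    (A : Algorithm w (base (2 ^ j))) → Solves (base (2 ^ j)) {{base≢0 (2 ^ j)}} A (2 ^ k) Y →
    bound (2 ^ j) w (2 ^ k) (sumInternal I (balanced k))
    ≤ expectedTime (base (2 ^ j)) {{base≢0 (2 ^ j)}} A (2 ^ k)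
lemma8 k j w Y Y< I isI A solves =
  scaled-bound δ s (sum (map time (upTo Qn))) (n ℕ.∸ 1) (8 ℕ.* w) Qn {{m*n≢0 8 w}} {{m^n≢0 (base δ) n {{base≢0 δ}}}}
    (subst (λ T → δ ℕ.* s ℕ.* Qn ℕ.≤ T ℕ.* (8 ℕ.* w) ℕ.+ (n ℕ.∸ 1) ℕ.* Qn ℕ.* (8 ℕ.* w))
      (sym (sum-map-upTo Qn time))
      (TreeBound.time-bound w δ n Y Y< A solves I isI k refl))
  where
  δ n Qn s : ℕ
  δ = 2 ^ j
  n = 2 ^ k
  Qn = base δ ^ n
  s = sumInternal I (balanced k)
  time : ℕ → ℕ
  time X = Run.totalTime {{base≢0 δ}} A X n
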